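{- Fix $n\ge 1$. Let $X$ be the bar complex of the partial monoid $(\mathcal{NCP}(n),\circ)$ and let $N$ be the nerve of the poset $(\mathcal{NCP}(n),\mid)$. Then the lower decalage $\mathrm{Dec}_\bot(X)$ is isomorphic, as a simplicial set, to $N$.
   Context: A partition $\pi$ of $[m]=\{1,\dots,m\}$ is noncrossing if there are no two distinct blocks $B,C$ of $\pi$ and elements $a<b<c<d$ with $a,c\in B$, $b,d\in C$. $\mathcal{NCP}(m)$ is the set of noncrossing partitions of $[m]$; it is a lattice for refinement, written $\pi\mid\mu$ iff every block of $\pi$ is contained in a block of $\mu$, with join $\vee$. $0_n$ denotes the partition of $[n]$ into singletons. For $\alpha_1,\dots,\alpha_k\in\mathcal{NCP}(n)$, the perfect shuffle $\alpha_1\ast_n\cdots\ast_n\alpha_k$ is the partition of $[kn]$ whose blocks are the sets $\{k(x-1)+i : x\in B\}$ for $1\le i\le k$ and $B$ a block of $\alpha_i$. The $k$-tuple is called admissible if this partition is noncrossing. For $\alpha,\beta\in\mathcal{NCP}(n)$ with $(\alpha,\beta)$ admissible, the composition product is $\alpha\circ\beta:=\sqrt{(\alpha\ast_n\beta)\vee\{\{1,2\},\{3,4\},\dots,\{2n-1,2n\}\}}$, where the join is taken in $\mathcal{NCP}(2n)$ and, for $\gamma\in\mathcal{NCP}(2n)$ in which $2i-1$ and $2i$ lie in the same block for every $i$, $\sqrt{\gamma}\in\mathcal{NCP}(n)$ is the partition with blocks $\{i : 2i\in D\}$ for $D$ a block of $\gamma$. The product $\circ$ is defined only on admissible pairs;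 it makes $\mathcal{NCP}(n)$ a partial monoid with unit $0_n$ (associative in the sense that $(\alpha\circ\beta)\circ\gamma$ is defined iff $\alpha\circ(\beta\circ\gamma)$ is, and then they agree). The bar complex $X$ of this partial monoid is the simplicial set with $X_0$ a point and $X_k$ the set of admissible $k$-tuples $(\alpha_1,\dots,\alpha_k)$ of elements of $\mathcal{NCP}(n)$; the face map $d_0$ deletes $\alpha_1$, $d_k$ deletes $\alpha_k$, and $d_i$ for $0<i<k$ replaces $\alpha_i,\alpha_{i+1}$ by $\alpha_i\circ\alpha_{i+1}$; the degeneracy $s_i$ inserts $0_n$ in position $i+1$. The nerve $N$ of the poset has $N_k$ the set of multichains $x_0\mid x_1\mid\cdots\mid x_k$ in $\mathcal{NCP}(n)$, with $d_i$ deleting $x_i$ and $s_i$ repeating $x_i$. For a simplicial set $Y$, its lower decalage $\mathrm{Dec}_\bot(Y)$ is the simplicial set with $\mathrm{Dec}_\bot(Y)_k=Y_{k+1}$, face maps $d_i^{\mathrm{Dec}}=d_{i+1}^{Y}$ and degeneracies $s_i^{\mathrm{Dec}}=s_{i+1}^{Y}$. -}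

module Defs where

open import Data.Bool using (Bool; true; false; _∧_; _∨_; not; T; if_then_else_)
open import Data.Nat using (ℕ; zero; suc; _+_; _*_; _≡ᵇ_; _<ᵇ_; _≤ᵇ_)
open import Data.Nat.DivMod using (_/_; _%_)
open import Data.List using (List; []; _∷_; map; concatMap; upTo; filterᵇ; length)
open import Data.Vec using (Vec; []; _∷_; insertAt; removeAt; lookup; toList)
open import Data.Fin using (Fin; zero; suc; inject₁)
open import Data.Maybe using (Maybe; just; nothing)
open import Relation.Binary.PropositionalEquality using (_≡_)

-- Ground set [m] = {1,…,m} is encoded 0-indexed as {0,…,m-1}.
-- A (raw) set partition of [m] is encoded canonically as a list of
-- length m whose i-th entry is the least element of the block of i.
-- Hence two partitions are equal iff their encodings are equal (≡).

RawPart : Set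
RawPart = List ℕ

all : {A : Set} → (A → Bool) → List A → Bool
all p []       = true
all p (x ∷ xs) = p x ∧ all p xs

-- i-th entry of a list (default 0 out of range; only used in range)
at : List ℕ → ℕ → ℕ
at []       _       = 0
at (x ∷ _)  zero    = x
at (_ ∷ xs) (suc i) = at xs i

atL : List RawPart → ℕ → RawPart
atL []       _       = []
atL (x ∷ _)  zero    = x
atL (_ ∷ xs) (suc i) = atL xs i

same : RawPart → ℕ → ℕ → Bool
same π i j = at π i ≡ᵇ at π j

-- first element of a list satisfying p (default 0)
first : (ℕ → Bool) → List ℕ → ℕ
first p []       = 0
first p (x ∷ xs) = if p x then x else first p xs

canon : ℕ → (ℕ → ℕ → Bool) → RawPart
canon m R = map (λ i → first (R i) (upTo m)) (upTo m)

isPartition : ℕ → RawPart → Bool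
isPartition m l =
  (length l ≡ᵇ m) ∧
  all (λ i → (at l i ≤ᵇ i) ∧ (at l (at l i) ≡ᵇ at l i)) (upTo m)

noncrossing : ℕ → RawPart → Bool
noncrossing m l =
  all (λ a → all (λ b → all (λ c → all (λ d →
    not ((a <ᵇ b) ∧ (b <ᵇ c) ∧ (c <ᵇ d) ∧
         same l a c ∧ same l b d ∧ not (same l a b)))
    (upTo m)) (upTo m)) (upTo m)) (upTo m)

isNCP : ℕ → RawPart → Bool
isNCP m l = isPartition m l ∧ noncrossing m l

refines : ℕ → RawPart → RawPart → Bool
refines m π μ =
  all (λ i → all (λ j → not (same π i j) ∨ same μ i j) (upTo m)) (upTo m)

lists : ℕ → ℕ → List (List ℕ)
lists zero    b = [] ∷ []
lists (suc m) b = concatMap (λ x → map (x ∷_) (lists m b)) (upTo b)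

allNCP : ℕ → List RawPart
allNCP m = filterᵇ (isNCP m) (lists m m)

joinNC : ℕ → RawPart → RawPart → RawPart
joinNC m π σ = canon m (λ i j →
  all (λ ρ → not (refines m π ρ ∧ refines m σ ρ) ∨ same ρ i j) (allNCP m))

-- perfect shuffle α₁ ∗ₙ ⋯ ∗ₙ αₖ, a partition of [kn]:
-- 1-indexed position k(x-1)+i  ↔  0-indexed p with p / k = x-1, p % k = i-1
shuffle : ℕ → List RawPart → RawPart
shuffle n []         = []
shuffle n (α ∷ rest) =
  canon (k * n) (λ p q →
    ((p % k) ≡ᵇ (q % k)) ∧ same (atL αs (p % k)) (p / k) (q / k))
  where
    αs = α ∷ rest
    k  = suc (length rest)

admissible : ℕ → List RawPart → Bool
admissible n αs = noncrossing (length αs * n) (shuffle n αs)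

pairing : ℕ → RawPart
pairing n = canon (2 * n) (λ p q → (p / 2) ≡ᵇ (q / 2))

-- √γ : blocks {i : 2i ∈ D}  (1-indexed 2i ↔ 0-indexed 2i'+1 with i' = i-1)
sqrtP : ℕ → RawPart → RawPart
sqrtP n γ = canon n (λ i j → same γ (2 * i + 1) (2 * j + 1))

compose : ℕ → RawPart → RawPart → RawPart
compose n α β = sqrtP n (joinNC (2 * n) (shuffle n (α ∷ β ∷ [])) (pairing n))

zeroP : ℕ → RawPart
zeroP n = upTo n

-- Simplicial sets, presented as a decidable subset  X_k ⊆ Raw k  of an
-- ambient family with face/degeneracy operations; only their
-- restrictions to the X_k matter.
--   face k i : X_{k+1} → X_k   (d_i, 0 ≤ i ≤ k+1)
--   degen k i : X_k → X_{k+1}  (s_i, 0 ≤ i ≤ k)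

record SimplicialSet : Set₁ where
  field
    Raw   : ℕ → Set
    In    : (k : ℕ) → Raw k → Bool
    face  : (k : ℕ) → Fin (suc (suc k)) → Raw (suc k) → Raw k
    degen : (k : ℕ) → Fin (suc k) → Raw k → Raw (suc k)

open SimplicialSet

record _≅_ (X Y : SimplicialSet) : Set where
  field
    to      : (k : ℕ) → Raw X k → Raw Y k
    from    : (k : ℕ) → Raw Y k → Raw X k
    to-in   : (k : ℕ) (x : Raw X k) → T (In X k x) → T (In Y k (to k x))
    from-in : (k : ℕ) (y : Raw Y k) → T (In Y k y) → T (In X k (from k y))
    from-to : (k : ℕ) (x : Raw X k) → T (In X k x) → from k (to k x) ≡ x
    to-from : (k : ℕ) (y : Raw Y k) → T (In Y k y) → to k (from k y) ≡ y
    to-face : (k : ℕ) (i : Fin (suc (suc k))) (x : Raw X (suc k)) →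
              T (In X (suc k) x) → to k (face X k i x) ≡ face Y k i (to (suc k) x)
    to-degen : (k : ℕ) (i : Fin (suc k)) (x : Raw X k) →
               T (In X k x) → to (suc k) (degen X k i x) ≡ degen Y k i (to k x)

Decalage : SimplicialSet → SimplicialSet
Decalage Y = record
  { Raw   = λ k → Raw Y (suc k)
  ; In    = λ k → In Y (suc k)
  ; face  = λ k i → face Y (suc k) (suc i)
  ; degen = λ k i → degen Y (suc k) (suc i)
  }

allB : {k : ℕ} → (RawPart → Bool) → Vec RawPart k → Bool
allB p []       = true
allB p (x ∷ xs) = p x ∧ allB p xs

barFace : (n : ℕ) {k : ℕ} → Fin (suc (suc k)) → Vec RawPart (suc k) → Vec RawPart k
barFace n zero                (a ∷ as)     = as
barFace n (suc zero)          (a ∷ [])     = []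
barFace n (suc (suc ()))      (a ∷ [])
barFace n (suc zero)          (a ∷ b ∷ as) = compose n a b ∷ as
barFace n (suc (suc i))       (a ∷ b ∷ as) = a ∷ barFace n (suc i) (b ∷ as)

Bar : ℕ → SimplicialSet
Bar n = record
  { Raw   = λ k → Vec RawPart k
  ; In    = λ k αs → allB (isNCP n) αs ∧ admissible n (toList αs)
  ; face  = λ k i αs → barFace n i αs
  ; degen = λ k i αs → insertAt αs i (zeroP n)
  }

chain : ℕ → {k : ℕ} → Vec RawPart k → Bool
chain n []           = true
chain n (x ∷ [])     = true
chain n (x ∷ y ∷ xs) = refines n x y ∧ chain n (y ∷ xs)

Nerve : ℕ → SimplicialSet
Nerve n = record
  { Raw   = λ k → Vec RawPart (suc k)
  ; In    = λ k xs → allB (isNCP n) xs ∧ chain n xs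
  ; face  = λ k i xs → removeAt xs i
  ; degen = λ k i xs → insertAt xs (inject₁ i) (lookup xs i)
  }

-- An admissible tuple (α₀, …, αₖ) goes to the multichain of its partial joins
-- α₀ ∣ α₀ ∨ α₁ ∣ ⋯ ∣ α₀ ∨ ⋯ ∨ αₖ, and a multichain x₀ ∣ ⋯ ∣ xₖ goes back to
-- (x₀, K(x₀, x₁), …, K(xₖ₋₁, xₖ)), where K(γ, δ) is the Kreweras complement of γ relative to δ.
-- Faces match because α ∘ β = α ∨ β.  A tuple is admissible iff all its pairs (αᵢ, αⱼ), i < j,
-- are, and (γ, β) is admissible iff the window (x, y] between any two β-related points is a
-- union of γ-blocks.  In these terms K(γ, δ) relates x, y ∈ B ∈ δ whose window is a union of
-- γ-blocks, and the two maps are inverse because γ ∨ K(γ, δ) = δ for γ ∣ δ and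
-- K(γ, γ ∨ β) = β for (γ, β) admissible.

{-# OPTIONS --safe #-}
module Submission where

open import Defs
open import Data.Bool using (Bool; true; false; _∧_; _∨_; not; T; _xor_; if_then_else_)
open import Data.Bool.Properties using (T?; T-≡; T-not-≡; xor-comm; xor-same; xor-assoc; ∧-zeroʳ)
open import Data.Empty using (⊥; ⊥-elim)
open import Data.Fin using (Fin; zero; suc; inject₁)
open import Data.List using (List; []; _∷_; map; upTo; applyUpTo; length)
open import Data.List.Membership.Propositional using (_∈_)
open import Data.List.Membership.Propositional.Properties
  using (∈-upTo⁺; ∈-upTo⁻; ∈-map⁺; ∈-concat⁺′; ∈-filter⁺; ∈-filter⁻)
open import Data.List.Properties using (map-upTo; length-map; length-upTo)
open import Data.List.Relation.Unary.All using (All; []; _∷_)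
open import Data.List.Relation.Unary.AllPairs using (AllPairs; []; _∷_)
open import Data.List.Relation.Unary.Any using (here; there)
open import Data.Nat
  using (ℕ; zero; suc; _+_; _*_; _≡ᵇ_; _<ᵇ_; _≤ᵇ_; _≤_; _<_; z≤n; s≤s; z<s; s<s; NonZero)
open import Data.Nat.DivMod
open import Data.Nat.Divisibility using (n∣m*n)
open import Data.Nat.Induction using (<-rec)
open import Data.Nat.Properties
open import Data.Product using (Σ-syntax; _×_; _,_; proj₁; proj₂)
open import Data.Sum using (inj₁; inj₂)
open import Data.Unit using (tt)
open import Data.Vec using (Vec; []; _∷_; insertAt; removeAt; lookup; toList)
open import Function using (_∘_; id; Equivalence)
open import Relation.Binary using (Tri; tri<; tri≈; tri>)
open import Relation.Binary.PropositionalEquality hiding (J)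
open import Relation.Nullary using (¬_; yes; no)
open import Relation.Nullary.Decidable using (_×-dec_)

∧-intro : ∀ {a b} → T a → T b → T (a ∧ b)
∧-intro {true} _ q = q

∧-projˡ : ∀ {a b} → T (a ∧ b) → T a
∧-projˡ {true} _ = tt

∧-projʳ : ∀ a {b} → T (a ∧ b) → T b
∧-projʳ true q = q

not-∨-intro : ∀ {a b} → (T a → T b) → T (not a ∨ b)
not-∨-intro {false} _ = tt
not-∨-intro {true}  f = f tt

not-∨-elim : ∀ {a b} → T (not a ∨ b) → T a → T b
not-∨-elim {true} q _ = q

not-intro : ∀ {a} → ¬ T a → T (not a)
not-intro {false} _ = tt
not-intro {true}  f = f tt

not-elim : ∀ {a} → T (not a) → ¬ T a
not-elim {false} _ ()

T-ext : ∀ {a b} → (T a → T b) → (T b → T a) → a ≡ b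
T-ext {false} {false} _ _ = refl
T-ext {false} {true}  _ g = ⊥-elim (g tt)
T-ext {true}  {false} f _ = ⊥-elim (f tt)
T-ext {true}  {true}  _ _ = refl

T-not-xor⁺ : ∀ {a b} → a ≡ b → T (not (a xor b))
T-not-xor⁺ {false} refl = tt
T-not-xor⁺ {true}  refl = tt

T-not-xor⁻ : ∀ {a b} → T (not (a xor b)) → a ≡ b
T-not-xor⁻ {false} {false} _ = refl
T-not-xor⁻ {true}  {true}  _ = refl

true≢false : true ≢ false
true≢false ()

all⁺ : {A : Set} (p : A → Bool) (xs : List A) → (∀ {x} → x ∈ xs → T (p x)) → T (all p xs)
all⁺ p []       _ = tt
all⁺ p (x ∷ xs) h = ∧-intro (h (here refl)) (all⁺ p xs (h ∘ there))

all⁻ : {A : Set} (p : A → Bool) (xs : List A) → T (all p xs) → ∀ {x} → x ∈ xs → T (p x)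
all⁻ p (x ∷ xs) h (here refl) = ∧-projˡ h
all⁻ p (x ∷ xs) h (there x∈)  = all⁻ p xs (∧-projʳ (p x) h) x∈

all-upTo⁺ : (p : ℕ → Bool) (m : ℕ) → (∀ i → i < m → T (p i)) → T (all p (upTo m))
all-upTo⁺ p m h = all⁺ p (upTo m) (λ i∈ → h _ (∈-upTo⁻ i∈))

all-upTo⁻ : (p : ℕ → Bool) (m : ℕ) → T (all p (upTo m)) → ∀ i → i < m → T (p i)
all-upTo⁻ p m h i i<m = all⁻ p (upTo m) h (∈-upTo⁺ i<m)

at-applyUpTo : (f : ℕ → ℕ) {m i : ℕ} → i < m → at (applyUpTo f m) i ≡ f i
at-applyUpTo f {suc m} {zero}  _         = refl
at-applyUpTo f {suc m} {suc i} (s<s i<m) = at-applyUpTo (f ∘ suc) i<m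

at-map-upTo : (f : ℕ → ℕ) {m i : ℕ} → i < m → at (map f (upTo m)) i ≡ f i
at-map-upTo f {m} i<m = trans (cong (λ l → at l _) (map-upTo f m)) (at-applyUpTo f i<m)

at-ext : (m : ℕ) (l l′ : List ℕ) → length l ≡ m → length l′ ≡ m →
         (∀ i → i < m → at l i ≡ at l′ i) → l ≡ l′
at-ext zero    []      []       _ _ _ = refl
at-ext (suc m) (x ∷ l) (y ∷ l′) e e′ h =
  cong₂ _∷_ (h 0 z<s) (at-ext m l l′ (suc-injective e) (suc-injective e′) (λ i i<m → h (suc i) (s<s i<m)))

first-least : (p : ℕ → Bool) (f : ℕ → ℕ) (m j : ℕ) → j < m → T (p (f j)) →
  Σ[ j₀ ∈ ℕ ] (j₀ ≤ j × T (p (f j₀)) × (∀ j′ → j′ < j₀ → ¬ T (p (f j′))) ×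
               first p (applyUpTo f m) ≡ f j₀)
first-least p f (suc m) j j<m pj with p (f zero) in eq
... | true = zero , z≤n , subst T (sym eq) tt , (λ _ ()) , refl
first-least p f (suc m) zero    _         pj | false = ⊥-elim (subst T eq pj)
first-least p f (suc m) (suc j) (s<s j<m) pj | false
  with j₀ , j₀≤j , pj₀ , least , e ← first-least p (f ∘ suc) m j j<m pj =
  suc j₀ , s≤s j₀≤j , pj₀ ,
  (λ { zero _ p0 → subst T eq p0 ; (suc j′) (s<s j′<j₀) → least j′ j′<j₀ }) , e

first-cong : (p q : ℕ → Bool) (f : ℕ → ℕ) (m : ℕ) → (∀ j → j < m → p (f j) ≡ q (f j)) →
  first p (applyUpTo f m) ≡ first q (applyUpTo f m)
first-cong p q f zero    h = refl
first-cong p q f (suc m) h rewrite h 0 z<s with q (f zero)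
... | true  = refl
... | false = first-cong p q (f ∘ suc) m (λ j j<m → h (suc j) (s<s j<m))

-- Canonical encodings of partitions

Same : RawPart → ℕ → ℕ → Set
Same l i j = at l i ≡ at l j

same⁺ : ∀ l {i j} → Same l i j → T (same l i j)
same⁺ l = ≡⇒≡ᵇ _ _

same⁻ : ∀ l {i j} → T (same l i j) → Same l i j
same⁻ l = ≡ᵇ⇒≡ _ _

record IsEquivalenceᵇ (R : ℕ → ℕ → Bool) : Set where
  field
    reflᵇ  : ∀ i → T (R i i)
    symᵇ   : ∀ i j → T (R i j) → T (R j i)
    transᵇ : ∀ i j k → T (R i j) → T (R j k) → T (R i k)

open IsEquivalenceᵇ

same-isEquivalenceᵇ : (l : RawPart) → IsEquivalenceᵇ (same l)
same-isEquivalenceᵇ l = record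
  { reflᵇ  = λ i → same⁺ l refl
  ; symᵇ   = λ i j p → same⁺ l (sym (same⁻ l p))
  ; transᵇ = λ i j k p q → same⁺ l (trans (same⁻ l p) (same⁻ l q))
  }

at-canon : ∀ {m} R {i} → i < m → at (canon m R) i ≡ first (R i) (upTo m)
at-canon {m} R = at-map-upTo (λ i → first (R i) (upTo m))

length-canon : ∀ m R → length (canon m R) ≡ m
length-canon m R = trans (length-map _ (upTo m)) (length-upTo m)

canon-cong : ∀ m R R′ → (∀ i j → i < m → j < m → R i j ≡ R′ i j) → canon m R ≡ canon m R′
canon-cong m R R′ h = at-ext m _ _ (length-canon m R) (length-canon m R′) λ i i<m → begin
  at (canon m R) i          ≡⟨ at-canon R i<m ⟩
  first (R i) (upTo m)      ≡⟨ first-cong (R i) (R′ i) id m (λ j j<m → h i j i<m j<m) ⟩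
  first (R′ i) (upTo m)     ≡⟨ at-canon R′ i<m ⟨
  at (canon m R′) i         ∎
  where open ≡-Reasoning

module _ {R : ℕ → ℕ → Bool} (E : IsEquivalenceᵇ R) where

  first-least-related : ∀ m i → i < m →
    Σ[ j₀ ∈ ℕ ] (j₀ ≤ i × T (R i j₀) × (∀ j → j < j₀ → ¬ T (R i j)) × first (R i) (upTo m) ≡ j₀)
  first-least-related m i i<m = first-least (R i) id m i i<m (reflᵇ E i)

  Same-canon⁺ : ∀ {m} i j → i < m → j < m → T (R i j) → Same (canon m R) i j
  Same-canon⁺ {m} i j i<m j<m r = begin
    at (canon m R) i          ≡⟨ at-canon R i<m ⟩
    first (R i) (upTo m)      ≡⟨ first-cong (R i) (R j) id m (λ k _ → T-ext (transᵇ E j i k (symᵇ E i j r))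
                                                                        (transᵇ E i j k r)) ⟩
    first (R j) (upTo m)      ≡⟨ at-canon R j<m ⟨
    at (canon m R) j          ∎
    where open ≡-Reasoning

  related-at-canon : ∀ {m} i → i < m → T (R i (at (canon m R) i))
  related-at-canon {m} i i<m with j₀ , _ , r , _ , e ← first-least-related m i i<m =
    subst (T ∘ R i) (sym (trans (at-canon R i<m) e)) r

  Same-canon⁻ : ∀ {m} i j → i < m → j < m → Same (canon m R) i j → T (R i j)
  Same-canon⁻ i j i<m j<m s =
    transᵇ E i _ j (related-at-canon i i<m)
      (symᵇ E j _ (subst (T ∘ R j) (sym s) (related-at-canon j j<m)))

  at-canon≤ : ∀ {m} i → i < m → at (canon m R) i ≤ i
  at-canon≤ {m} i i<m with j₀ , j₀≤i , _ , _ , e ← first-least-related m i i<m =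
    subst (_≤ i) (sym (trans (at-canon R i<m) e)) j₀≤i

  canon-isPartition : ∀ m → T (isPartition m (canon m R))
  canon-isPartition m = ∧-intro (≡⇒≡ᵇ _ _ (length-canon m R)) (all-upTo⁺ _ m λ i i<m →
    let c≤i = at-canon≤ i i<m
    in ∧-intro (≤⇒≤ᵇ c≤i)
         (same⁺ (canon m R) (Same-canon⁺ _ i (≤-<-trans c≤i i<m) i<m
           (symᵇ E i _ (related-at-canon i i<m)))))

record IsPartition (m : ℕ) (l : RawPart) : Set where
  field
    length≡ : length l ≡ m
    at≤     : ∀ {i} → i < m → at l i ≤ i
    at-idem : ∀ {i} → i < m → at l (at l i) ≡ at l i

  at< : ∀ {i} → i < m → at l i < m
  at< i<m = ≤-<-trans (at≤ i<m) i<m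

  Same-at : ∀ {i} → i < m → Same l i (at l i)
  Same-at i<m = sym (at-idem i<m)

  at≤-block : ∀ {u v} → u < m → Same l u v → at l v ≤ u
  at≤-block u<m s = subst (_≤ _) s (at≤ u<m)

isPartition⁻ : ∀ {m l} → T (isPartition m l) → IsPartition m l
isPartition⁻ {m} {l} h = record
  { length≡ = ≡ᵇ⇒≡ _ _ (∧-projˡ h)
  ; at≤     = λ i<m → ≤ᵇ⇒≤ _ _ (∧-projˡ (entry i<m))
  ; at-idem = λ {i} i<m → ≡ᵇ⇒≡ _ _ (∧-projʳ (at l i ≤ᵇ i) (entry i<m))
  }
  where
    entry : ∀ {i} → i < m → T ((at l i ≤ᵇ i) ∧ (at l (at l i) ≡ᵇ at l i))
    entry = all-upTo⁻ _ m (∧-projʳ (length l ≡ᵇ m) h) _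

canon-same : ∀ {m l} → T (isPartition m l) → canon m (same l) ≡ l
canon-same {m} {l} h = at-ext m _ l (length-canon m (same l)) length≡ λ i i<m →
  trans (at-canon (same l) i<m) (least-representative i i<m)
  where
    open IsPartition (isPartition⁻ {m} {l} h)
    least-representative : ∀ i → i < m → first (same l i) (upTo m) ≡ at l i
    least-representative i i<m
      with j₀ , j₀≤i , r , least , e ← first-least-related (same-isEquivalenceᵇ l) m i i<m
      with <-cmp j₀ (at l i)
    ... | tri≈ _ j₀≡ _ = trans e j₀≡
    ... | tri< j₀< _ _ = ⊥-elim (<⇒≱ j₀< (at≤-block (≤-<-trans j₀≤i i<m) (sym (same⁻ l r))))
    ... | tri> _ _ >j₀ = ⊥-elim (least (at l i) >j₀ (same⁺ l (Same-at i<m)))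

partition-ext : ∀ {m l l′} → T (isPartition m l) → T (isPartition m l′) →
  (∀ i j → i < m → j < m → Same l i j → Same l′ i j) →
  (∀ i j → i < m → j < m → Same l′ i j → Same l i j) → l ≡ l′
partition-ext {m} {l} {l′} h h′ f g = begin
  l                 ≡⟨ canon-same h ⟨
  canon m (same l)  ≡⟨ canon-cong m _ _ (λ i j i<m j<m →
                         T-ext (same⁺ l′ ∘ f i j i<m j<m ∘ same⁻ l) (same⁺ l ∘ g i j i<m j<m ∘ same⁻ l′)) ⟩
  canon m (same l′) ≡⟨ canon-same h′ ⟩
  l′                ∎
  where open ≡-Reasoning

Noncrossing : ℕ → (ℕ → ℕ → Bool) → Set
Noncrossing m R = ∀ a b c d → a < b → b < c → c < d → d < m → T (R a c) → T (R b d) → T (R a b)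

noncrossing⁺ : ∀ m l → Noncrossing m (same l) → T (noncrossing m l)
noncrossing⁺ m l nc =
  all-upTo⁺ _ m λ a _ → all-upTo⁺ _ m λ b _ → all-upTo⁺ _ m λ c _ → all-upTo⁺ _ m λ d d<m →
    not-intro λ crossing →
      let ab = <ᵇ⇒< a b (∧-projˡ crossing)
          h₁ = ∧-projʳ (a <ᵇ b) crossing
          bc = <ᵇ⇒< b c (∧-projˡ h₁)
          h₂ = ∧-projʳ (b <ᵇ c) h₁
          cd = <ᵇ⇒< c d (∧-projˡ h₂)
          h₃ = ∧-projʳ (c <ᵇ d) h₂
          h₄ = ∧-projʳ (same l a c) h₃
      in not-elim (∧-projʳ (same l b d) h₄) (nc a b c d ab bc cd d<m (∧-projˡ h₃) (∧-projˡ h₄))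

noncrossing⁻ : ∀ m l → T (noncrossing m l) → Noncrossing m (same l)
noncrossing⁻ m l h a b c d ab bc cd d<m ac bd with T? (same l a b)
... | yes ab-same = ab-same
... | no ab-apart =
  let c<m = <-trans cd d<m
      b<m = <-trans bc c<m
      a<m = <-trans ab b<m
      entry = all-upTo⁻ _ m (all-upTo⁻ _ m (all-upTo⁻ _ m (all-upTo⁻ _ m h a a<m) b b<m) c c<m) d d<m
  in ⊥-elim (not-elim entry
       (∧-intro (<⇒<ᵇ ab) (∧-intro (<⇒<ᵇ bc) (∧-intro (<⇒<ᵇ cd)
         (∧-intro ac (∧-intro bd (not-intro ab-apart)))))))

NCP : ℕ → RawPart → Set
NCP m l = T (isNCP m l)

NCP⇒partition : ∀ {m} l → NCP m l → IsPartition m l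
NCP⇒partition l h = isPartition⁻ {l = l} (∧-projˡ h)

NCP⇒noncrossing : ∀ {m} l → NCP m l → Noncrossing m (same l)
NCP⇒noncrossing {m} l h = noncrossing⁻ m l (∧-projʳ (isPartition m l) h)

canon-NCP : ∀ {m R} → IsEquivalenceᵇ R → Noncrossing m R → NCP m (canon m R)
canon-NCP {m} {R} E nc = ∧-intro (canon-isPartition E m) (noncrossing⁺ m (canon m R)
  λ a b c d ab bc cd d<m ac bd →
    let c<m = <-trans cd d<m
        b<m = <-trans bc c<m
        a<m = <-trans ab b<m
    in same⁺ (canon m R) (Same-canon⁺ E a b a<m b<m (nc a b c d ab bc cd d<m
         (Same-canon⁻ E a c a<m c<m (same⁻ (canon m R) ac))
         (Same-canon⁻ E b d b<m d<m (same⁻ (canon m R) bd)))))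

pullback-isEquivalenceᵇ : ∀ {R} (f : ℕ → ℕ) → IsEquivalenceᵇ R → IsEquivalenceᵇ (λ x y → R (f x) (f y))
pullback-isEquivalenceᵇ f E = record
  { reflᵇ  = λ x → reflᵇ E (f x)
  ; symᵇ   = λ x y → symᵇ E (f x) (f y)
  ; transᵇ = λ x y z → transᵇ E (f x) (f y) (f z)
  }

-- f need not be injective: coinciding images are absorbed by reflexivity and transitivity.
pullback-noncrossing : ∀ {m n R} (f : ℕ → ℕ) → IsEquivalenceᵇ R → Noncrossing m R →
  (∀ {x y} → x ≤ y → f x ≤ f y) → (∀ {x} → x < n → f x < m) →
  Noncrossing n (λ x y → R (f x) (f y))
pullback-noncrossing {R = R} f E nc mono bound a b c d ab bc cd d<n ac bd
  with m≤n⇒m<n∨m≡n (mono (<⇒≤ ab)) | m≤n⇒m<n∨m≡n (mono (<⇒≤ bc)) | m≤n⇒m<n∨m≡n (mono (<⇒≤ cd))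
... | inj₂ fa≡fb | _ | _ = subst (T ∘ R (f a)) fa≡fb (reflᵇ E (f a))
... | inj₁ _ | inj₂ fb≡fc | _ = subst (T ∘ R (f a)) (sym fb≡fc) ac
... | inj₁ _ | inj₁ _ | inj₂ fc≡fd =
  transᵇ E (f a) (f c) (f b) ac (symᵇ E (f b) (f c) (subst (T ∘ R (f b)) (sym fc≡fd) bd))
... | inj₁ fa<fb | inj₁ fb<fc | inj₁ fc<fd = nc (f a) (f b) (f c) (f d) fa<fb fb<fc fc<fd (bound d<n) ac bd

block-inside-arc : ∀ {m R} → IsEquivalenceᵇ R → Noncrossing m R → ∀ {a b c b′} →
  a < b → b < c → c < m → b′ < m → T (R a c) → ¬ T (R b a) → T (R b b′) → a < b′ × b′ < c
block-inside-arc {R = R} E nc {a} {b} {c} {b′} ab bc c<m b′<m ac ¬ba bb′ with <-cmp b′ a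
... | tri< b′a _ _ = ⊥-elim (¬ba (transᵇ E b b′ a bb′ (nc b′ a b c b′a ab bc c<m (symᵇ E b b′ bb′) ac)))
... | tri≈ _ refl _ = ⊥-elim (¬ba bb′)
... | tri> _ _ ab′ with <-cmp b′ c
...   | tri< b′c _ _ = ab′ , b′c
...   | tri≈ _ refl _ = ⊥-elim (¬ba (transᵇ E b c a bb′ (symᵇ E a c ac)))
...   | tri> _ _ cb′ = ⊥-elim (¬ba (symᵇ E a b (nc a b c b′ ab bc cb′ b′<m ac bb′)))

Refines : ℕ → RawPart → RawPart → Set
Refines m π μ = ∀ i j → i < m → j < m → Same π i j → Same μ i j

refines⁺ : ∀ m π μ → Refines m π μ → T (refines m π μ)
refines⁺ m π μ r = all-upTo⁺ _ m λ i i<m → all-upTo⁺ _ m λ j j<m →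
  not-∨-intro (same⁺ μ ∘ r i j i<m j<m ∘ same⁻ π)

refines⁻ : ∀ m π μ → T (refines m π μ) → Refines m π μ
refines⁻ m π μ h i j i<m j<m s =
  same⁻ μ (not-∨-elim (all-upTo⁻ _ m (all-upTo⁻ _ m h i i<m) j j<m) (same⁺ π s))

Refines-trans : ∀ {m} π μ ν → Refines m π μ → Refines m μ ν → Refines m π ν
Refines-trans _ _ _ r r′ i j i<m j<m = r′ i j i<m j<m ∘ r i j i<m j<m

∈-lists : ∀ m b (l : List ℕ) → length l ≡ m → (∀ i → i < m → at l i < b) → l ∈ lists m b
∈-lists zero    b []      _ _ = here refl
∈-lists (suc m) b (x ∷ l) e h =
  ∈-concat⁺′ (∈-map⁺ (x ∷_) (∈-lists m b l (suc-injective e) (λ i i<m → h (suc i) (s<s i<m))))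
             (∈-map⁺ (λ x → map (x ∷_) (lists m b)) (∈-upTo⁺ (h 0 z<s)))

∈-allNCP⁺ : ∀ {m} l → NCP m l → l ∈ allNCP m
∈-allNCP⁺ {m} l h = ∈-filter⁺ (T? ∘ isNCP m) (∈-lists m m l length≡ (λ i → at<)) h
  where open IsPartition (NCP⇒partition l h)

∈-allNCP⁻ : ∀ {m l} → l ∈ allNCP m → NCP m l
∈-allNCP⁻ {m} h = proj₂ (∈-filter⁻ (T? ∘ isNCP m) {xs = lists m m} h)

-- Joins in NCP(n)

module _ (n : ℕ) (a b : RawPart) where

  private
    upperBound : RawPart → Bool
    upperBound ρ = refines n a ρ ∧ refines n b ρ

  joinRel : ℕ → ℕ → Bool
  joinRel i j = all (λ ρ → not (upperBound ρ) ∨ same ρ i j) (allNCP n)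

  joinRel⁻ : ∀ {i j} → T (joinRel i j) →
             ∀ ρ → NCP n ρ → Refines n a ρ → Refines n b ρ → Same ρ i j
  joinRel⁻ h ρ ρ-ncp ra rb =
    same⁻ ρ (not-∨-elim (all⁻ _ (allNCP n) h (∈-allNCP⁺ ρ ρ-ncp)) (∧-intro (refines⁺ n a ρ ra) (refines⁺ n b ρ rb)))

  joinRel⁺ : ∀ {i j} → (∀ ρ → NCP n ρ → Refines n a ρ → Refines n b ρ → Same ρ i j) → T (joinRel i j)
  joinRel⁺ h = all⁺ _ (allNCP n) λ {ρ} ρ∈ → not-∨-intro λ ub →
    same⁺ ρ (h ρ (∈-allNCP⁻ ρ∈) (refines⁻ n a ρ (∧-projˡ ub)) (refines⁻ n b ρ (∧-projʳ (refines n a ρ) ub)))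

  joinRel-isEquivalenceᵇ : IsEquivalenceᵇ joinRel
  joinRel-isEquivalenceᵇ = record
    { reflᵇ  = λ i → joinRel⁺ λ _ _ _ _ → refl
    ; symᵇ   = λ i j p → joinRel⁺ λ ρ ρ-ncp ra rb → sym (joinRel⁻ p ρ ρ-ncp ra rb)
    ; transᵇ = λ i j k p q → joinRel⁺ λ ρ ρ-ncp ra rb →
                 trans (joinRel⁻ p ρ ρ-ncp ra rb) (joinRel⁻ q ρ ρ-ncp ra rb)
    }

  joinRel-noncrossing : Noncrossing n joinRel
  joinRel-noncrossing p q r s pq qr rs s<n pr qs = joinRel⁺ λ ρ ρ-ncp ra rb →
    same⁻ ρ (NCP⇒noncrossing ρ ρ-ncp p q r s pq qr rs s<n
      (same⁺ ρ (joinRel⁻ pr ρ ρ-ncp ra rb)) (same⁺ ρ (joinRel⁻ qs ρ ρ-ncp ra rb)))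

  join-NCP : NCP n (joinNC n a b)
  join-NCP = canon-NCP joinRel-isEquivalenceᵇ joinRel-noncrossing

  Same-join⁺ : ∀ i j → i < n → j < n → T (joinRel i j) → Same (joinNC n a b) i j
  Same-join⁺ = Same-canon⁺ joinRel-isEquivalenceᵇ

  Same-join⁻ : ∀ i j → i < n → j < n → Same (joinNC n a b) i j → T (joinRel i j)
  Same-join⁻ = Same-canon⁻ joinRel-isEquivalenceᵇ

  join-upperˡ : Refines n a (joinNC n a b)
  join-upperˡ i j i<n j<n s = Same-join⁺ i j i<n j<n (joinRel⁺ λ ρ _ ra _ → ra i j i<n j<n s)

  join-upperʳ : Refines n b (joinNC n a b)
  join-upperʳ i j i<n j<n s = Same-join⁺ i j i<n j<n (joinRel⁺ λ ρ _ _ rb → rb i j i<n j<n s)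

  join-least : ∀ ρ → NCP n ρ → Refines n a ρ → Refines n b ρ → Refines n (joinNC n a b) ρ
  join-least ρ ρ-ncp ra rb i j i<n j<n s = joinRel⁻ (Same-join⁻ i j i<n j<n s) ρ ρ-ncp ra rb

  join-least-relation : ∀ {R} → IsEquivalenceᵇ R → Noncrossing n R →
    (∀ i j → i < n → j < n → Same a i j → T (R i j)) →
    (∀ i j → i < n → j < n → Same b i j → T (R i j)) →
    ∀ i j → i < n → j < n → Same (joinNC n a b) i j → T (R i j)
  join-least-relation {R} E nc ha hb i j i<n j<n s =
    Same-canon⁻ E i j i<n j<n (join-least (canon n R) (canon-NCP E nc)
      (λ x y x<n y<n → Same-canon⁺ E x y x<n y<n ∘ ha x y x<n y<n)
      (λ x y x<n y<n → Same-canon⁺ E x y x<n y<n ∘ hb x y x<n y<n) i j i<n j<n s)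

join-assoc : ∀ n a b c → joinNC n a (joinNC n b c) ≡ joinNC n (joinNC n a b) c
join-assoc n a b c = canon-cong n _ _ λ i j i<n j<n → T-ext
  (λ h → joinRel⁺ n (joinNC n a b) c λ ρ ρ-ncp rab rc →
     joinRel⁻ n a (joinNC n b c) h ρ ρ-ncp (Refines-trans a (joinNC n a b) ρ (join-upperˡ n a b) rab)
       (join-least n b c ρ ρ-ncp (Refines-trans b (joinNC n a b) ρ (join-upperʳ n a b) rab) rc))
  (λ h → joinRel⁺ n a (joinNC n b c) λ ρ ρ-ncp ra rbc →
     joinRel⁻ n (joinNC n a b) c h ρ ρ-ncp
       (join-least n a b ρ ρ-ncp ra (Refines-trans b (joinNC n b c) ρ (join-upperˡ n b c) rbc))
       (Refines-trans c (joinNC n b c) ρ (join-upperʳ n b c) rbc))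

join-zeroʳ : ∀ n a → NCP n a → joinNC n a (zeroP n) ≡ a
join-zeroʳ n a a-ncp = partition-ext (∧-projˡ (join-NCP n a (zeroP n))) (∧-projˡ a-ncp)
  (join-least n a (zeroP n) a a-ncp (λ _ _ _ _ s → s)
    (λ i j i<n j<n s → cong (at a) (trans (sym (at-applyUpTo id i<n)) (trans s (at-applyUpTo id j<n)))))
  (join-upperˡ n a (zeroP n))

-- Windows

-- window x y is the indicator of the half-open interval between x and y, (x, y] or (y, x];
-- writing it as a xor makes window x z the symmetric difference of window x y and window y z.
window : ℕ → ℕ → ℕ → Bool
window x y u = (u ≤ᵇ x) xor (u ≤ᵇ y)

≤ᵇ-true : ∀ {u t} → u ≤ t → (u ≤ᵇ t) ≡ true
≤ᵇ-true u≤t = Equivalence.to T-≡ (≤⇒≤ᵇ u≤t)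

≤ᵇ-false : ∀ {u t} → t < u → (u ≤ᵇ t) ≡ false
≤ᵇ-false {u} {t} t<u = Equivalence.to T-not-≡ (not-intro (<⇒≱ t<u ∘ ≤ᵇ⇒≤ u t))

window-inside : ∀ {x y u} → x < u → u ≤ y → window x y u ≡ true
window-inside x<u u≤y rewrite ≤ᵇ-false x<u | ≤ᵇ-true u≤y = refl

window-below : ∀ {x y u} → x ≤ y → u ≤ x → window x y u ≡ false
window-below x≤y u≤x rewrite ≤ᵇ-true u≤x | ≤ᵇ-true (≤-trans u≤x x≤y) = refl

window-above : ∀ {x y u} → x ≤ y → y < u → window x y u ≡ false
window-above x≤y y<u rewrite ≤ᵇ-false y<u | ≤ᵇ-false (≤-<-trans x≤y y<u) = refl

window-outside : ∀ {x y u} → x < y → ¬ (x < u × u ≤ y) → window x y u ≡ false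
window-outside {x} {y} {u} x<y outside with x <? u
... | yes x<u = window-above (<⇒≤ x<y) (≰⇒> λ u≤y → outside (x<u , u≤y))
... | no  x≮u = window-below (<⇒≤ x<y) (≮⇒≥ x≮u)

window-true⇒inside : ∀ {x y u} → x ≤ y → window x y u ≡ true → x < u × u ≤ y
window-true⇒inside {x} {y} {u} x≤y w with x <? u | u ≤? y
... | yes x<u | yes u≤y = x<u , u≤y
... | no  x≮u | _       = ⊥-elim (true≢false (trans (sym w) (window-below x≤y (≮⇒≥ x≮u))))
... | yes _   | no  u≰y = ⊥-elim (true≢false (trans (sym w) (window-above x≤y (≰⇒> u≰y))))

window-comm : ∀ x y u → window x y u ≡ window y x u
window-comm x y u = xor-comm (u ≤ᵇ x) (u ≤ᵇ y)

window-self : ∀ x u → window x x u ≡ false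
window-self x u = xor-same (u ≤ᵇ x)

window-trans : ∀ x y z u → window x y u xor window y z u ≡ window x z u
window-trans x y z u = begin
  (a xor b) xor (b xor c)  ≡⟨ xor-assoc a b (b xor c) ⟩
  a xor (b xor (b xor c))  ≡⟨ cong (a xor_) (xor-assoc b b c) ⟨
  a xor ((b xor b) xor c)  ≡⟨ cong (λ e → a xor (e xor c)) (xor-same b) ⟩
  a xor c                  ∎
  where
    open ≡-Reasoning
    a b c : Bool
    a = u ≤ᵇ x
    b = u ≤ᵇ y
    c = u ≤ᵇ z

window-convex-ordered : ∀ {x y u v w} → u < v → v < w → x ≤ y →
  window x y u ≡ true → window x y w ≡ true → window x y v ≡ true
window-convex-ordered u<v v<w x≤y wu ww = window-inside (<-trans (proj₁ (window-true⇒inside x≤y wu)) u<v)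
                                                        (<⇒≤ (<-≤-trans v<w (proj₂ (window-true⇒inside x≤y ww))))

window-convex : ∀ {x y u v w} → u < v → v < w → window x y u ≡ true → window x y w ≡ true → window x y v ≡ true
window-convex {x} {y} {u} {v} {w} u<v v<w wu ww with ≤-total x y
... | inj₁ x≤y = window-convex-ordered u<v v<w x≤y wu ww
... | inj₂ y≤x = trans (window-comm x y v)
  (window-convex-ordered u<v v<w y≤x (trans (window-comm y x u) wu) (trans (window-comm y x w) ww))

window-nested : ∀ {a b c d} → a < b → b < c → c < d → ∀ u → window b c u ≡ window a c u ∧ window b d u
window-nested {a} {b} {c} {d} ab bc cd u with b <? u | u ≤? c
... | no  b≮u | _ = trans (window-below (<⇒≤ bc) u≤b)
                          (sym (trans (cong (window a c u ∧_) (window-below (<⇒≤ (<-trans bc cd)) u≤b))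
                                      (∧-zeroʳ (window a c u))))
  where
    u≤b : u ≤ b
    u≤b = ≮⇒≥ b≮u
... | yes b<u | yes u≤c = trans (window-inside b<u u≤c)
                                (sym (cong₂ _∧_ (window-inside (<-trans ab b<u) u≤c)
                                                (window-inside b<u (≤-trans u≤c (<⇒≤ cd)))))
... | yes _   | no  u≰c = trans (window-above (<⇒≤ bc) (≰⇒> u≰c))
                                (sym (cong (_∧ window b d u) (window-above (<⇒≤ (<-trans ab bc)) (≰⇒> u≰c))))

BlockConstant : ℕ → RawPart → (ℕ → Bool) → Set
BlockConstant n γ f = ∀ u v → u < n → v < n → Same γ u v → f u ≡ f v

BlockConstant-refines : ∀ {n γ γ′ f} → Refines n γ γ′ → BlockConstant n γ′ f → BlockConstant n γ f
BlockConstant-refines r c u v u<n v<n = c u v u<n v<n ∘ r u v u<n v<n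

BlockConstant-window : ∀ {n} γ x y → x < y →
  (∀ u v → u < n → v < n → Same γ u v → x < u → u ≤ y → x < v × v ≤ y) → BlockConstant n γ (window x y)
BlockConstant-window γ x y x<y closed u v u<n v<n s with (x <? u) ×-dec (u ≤? y) | (x <? v) ×-dec (v ≤? y)
... | yes (x<u , u≤y) | _ = let (x<v , v≤y) = closed u v u<n v<n s x<u u≤y in
  trans (window-inside x<u u≤y) (sym (window-inside x<v v≤y))
... | no u-out | yes (x<v , v≤y) = ⊥-elim (u-out (closed v u v<n u<n (sym s) x<v v≤y))
... | no u-out | no v-out = trans (window-outside x<y u-out) (sym (window-outside x<y v-out))

sameSide : (ℕ → Bool) → ℕ → ℕ → Bool
sameSide f u v = not (f u xor f v)

sameSide⁺ : ∀ f u v → f u ≡ f v → T (sameSide f u v)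
sameSide⁺ f u v = T-not-xor⁺ {f u} {f v}

sameSide⁻ : ∀ f u v → T (sameSide f u v) → f u ≡ f v
sameSide⁻ f u v = T-not-xor⁻ {f u} {f v}

sameSide-isEquivalenceᵇ : ∀ f → IsEquivalenceᵇ (sameSide f)
sameSide-isEquivalenceᵇ f = record
  { reflᵇ  = λ u → sameSide⁺ f u u refl
  ; symᵇ   = λ u v p → sameSide⁺ f v u (sym (sameSide⁻ f u v p))
  ; transᵇ = λ u v w p q → sameSide⁺ f u w (trans (sameSide⁻ f u v p) (sameSide⁻ f v w q))
  }

-- Both crossing patterns contradict the convexity of a window.
sameSide-window-noncrossing : ∀ m x y → Noncrossing m (sameSide (window x y))
sameSide-window-noncrossing m x y a b c d ab bc cd _ ac bd =
  sameSide⁺ (window x y) a b (a-side≡b-side (sameSide⁻ (window x y) a c ac) (sameSide⁻ (window x y) b d bd))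
  where
    a-side≡b-side : window x y a ≡ window x y c → window x y b ≡ window x y d → window x y a ≡ window x y b
    a-side≡b-side a≡c b≡d with window x y a in wa | window x y b in wb
    ... | false | false = refl
    ... | true  | true  = refl
    ... | true  | false = ⊥-elim (true≢false (trans (sym (window-convex ab bc wa (sym a≡c))) wb))
    ... | false | true  = ⊥-elim (true≢false (trans (sym (window-convex bc cd wb (sym b≡d))) (sym a≡c)))

BlockConstant-join : ∀ {n} γ β x y → BlockConstant n γ (window x y) → BlockConstant n β (window x y) →
  BlockConstant n (joinNC n γ β) (window x y)
BlockConstant-join {n} γ β x y cγ cβ u v u<n v<n s =
  sameSide⁻ (window x y) u v (join-least-relation n γ β
    (sameSide-isEquivalenceᵇ (window x y)) (sameSide-window-noncrossing n x y)
    (λ i j i<n j<n → sameSide⁺ (window x y) i j ∘ cγ i j i<n j<n)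
    (λ i j i<n j<n → sameSide⁺ (window x y) i j ∘ cβ i j i<n j<n) u v u<n v<n s)

respectsWindow : ℕ → RawPart → ℕ → ℕ → Bool
respectsWindow n γ x y =
  all (λ u → all (λ v → not (same γ u v) ∨ sameSide (window x y) u v) (upTo n)) (upTo n)

respectsWindow⁺ : ∀ n γ x y → BlockConstant n γ (window x y) → T (respectsWindow n γ x y)
respectsWindow⁺ n γ x y c = all-upTo⁺ _ n λ u u<n → all-upTo⁺ _ n λ v v<n →
  not-∨-intro (sameSide⁺ (window x y) u v ∘ c u v u<n v<n ∘ same⁻ γ)

respectsWindow⁻ : ∀ n γ x y → T (respectsWindow n γ x y) → BlockConstant n γ (window x y)
respectsWindow⁻ n γ x y h u v u<n v<n s =
  sameSide⁻ (window x y) u v (not-∨-elim (all-upTo⁻ _ n (all-upTo⁻ _ n h u u<n) v v<n) (same⁺ γ s))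

respectsWindow-isEquivalenceᵇ : ∀ n γ → IsEquivalenceᵇ (respectsWindow n γ)
respectsWindow-isEquivalenceᵇ n γ = record
  { reflᵇ  = λ x → respectsWindow⁺ n γ x x λ u v _ _ _ →
      trans (window-self x u) (sym (window-self x v))
  ; symᵇ   = λ x y h → respectsWindow⁺ n γ y x λ u v u<n v<n s →
      trans (window-comm y x u) (trans (respectsWindow⁻ n γ x y h u v u<n v<n s) (window-comm x y v))
  ; transᵇ = λ x y z h h′ → respectsWindow⁺ n γ x z λ u v u<n v<n s →
      trans (sym (window-trans x y z u)) (trans
        (cong₂ _xor_ (respectsWindow⁻ n γ x y h u v u<n v<n s) (respectsWindow⁻ n γ y z h′ u v u<n v<n s))
        (window-trans x y z v))
  }

respectsWindow-noncrossing : ∀ n γ → Noncrossing n (respectsWindow n γ)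
respectsWindow-noncrossing n γ a b c d ab bc cd _ ac bd =
  transᵇ E a c b ac (symᵇ E b c (respectsWindow⁺ n γ b c λ u v u<n v<n s →
    trans (window-nested ab bc cd u) (trans
      (cong₂ _∧_ (respectsWindow⁻ n γ a c ac u v u<n v<n s) (respectsWindow⁻ n γ b d bd u v u<n v<n s))
      (sym (window-nested ab bc cd v)))))
  where
    E : IsEquivalenceᵇ (respectsWindow n γ)
    E = respectsWindow-isEquivalenceᵇ n γ

-- Relative Kreweras complements
krewerasRel : ℕ → RawPart → RawPart → ℕ → ℕ → Bool
krewerasRel n γ δ x y = same δ x y ∧ respectsWindow n γ x y

kreweras : ℕ → RawPart → RawPart → RawPart
kreweras n γ δ = canon n (krewerasRel n γ δ)

krewerasRel-isEquivalenceᵇ : ∀ n γ δ → IsEquivalenceᵇ (krewerasRel n γ δ)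
krewerasRel-isEquivalenceᵇ n γ δ = record
  { reflᵇ  = λ x → ∧-intro (reflᵇ D x) (reflᵇ W x)
  ; symᵇ   = λ x y h → ∧-intro (symᵇ D x y (∧-projˡ h)) (symᵇ W x y (∧-projʳ (same δ x y) h))
  ; transᵇ = λ x y z h h′ → ∧-intro (transᵇ D x y z (∧-projˡ h) (∧-projˡ h′))
                                    (transᵇ W x y z (∧-projʳ (same δ x y) h) (∧-projʳ (same δ y z) h′))
  }
  where
    D : IsEquivalenceᵇ (same δ)
    D = same-isEquivalenceᵇ δ
    W : IsEquivalenceᵇ (respectsWindow n γ)
    W = respectsWindow-isEquivalenceᵇ n γ

kreweras-NCP : ∀ n γ δ → NCP n δ → NCP n (kreweras n γ δ)
kreweras-NCP n γ δ δ-ncp = canon-NCP (krewerasRel-isEquivalenceᵇ n γ δ)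
  λ a b c d ab bc cd d<n ac bd →
    ∧-intro (NCP⇒noncrossing δ δ-ncp a b c d ab bc cd d<n (∧-projˡ ac) (∧-projˡ bd))
            (respectsWindow-noncrossing n γ a b c d ab bc cd d<n (∧-projʳ (same δ a c) ac) (∧-projʳ (same δ b d) bd))

Same-kreweras⁻ : ∀ n γ δ x y → x < n → y < n → Same (kreweras n γ δ) x y →
  Same δ x y × BlockConstant n γ (window x y)
Same-kreweras⁻ n γ δ x y x<n y<n s =
  let h = Same-canon⁻ (krewerasRel-isEquivalenceᵇ n γ δ) x y x<n y<n s
  in same⁻ δ (∧-projˡ h) , respectsWindow⁻ n γ x y (∧-projʳ (same δ x y) h)

Same-kreweras⁺ : ∀ n γ δ x y → x < n → y < n → Same δ x y → BlockConstant n γ (window x y) →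
  Same (kreweras n γ δ) x y
Same-kreweras⁺ n γ δ x y x<n y<n s c =
  Same-canon⁺ (krewerasRel-isEquivalenceᵇ n γ δ) x y x<n y<n (∧-intro (same⁺ δ s) (respectsWindow⁺ n γ x y c))

AdmissiblePair : ℕ → RawPart → RawPart → Set
AdmissiblePair n γ β = ∀ x y → x < n → y < n → Same β x y → BlockConstant n γ (window x y)

AdmissiblePair-from-ordered : ∀ {n} γ β →
  (∀ x y u v → x < y → u < v → y < n → v < n → Same β x y → Same γ u v → window x y u ≡ window x y v) →
  AdmissiblePair n γ β
AdmissiblePair-from-ordered γ β ordered x y x<n y<n x~y u v u<n v<n u~v with <-cmp x y | <-cmp u v
... | tri≈ _ refl _ | _ = trans (window-self x u) (sym (window-self x v))
... | _ | tri≈ _ refl _ = refl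
... | tri< x<y _ _ | tri< u<v _ _ = ordered x y u v x<y u<v y<n v<n x~y u~v
... | tri< x<y _ _ | tri> _ _ v<u = sym (ordered x y v u x<y v<u y<n u<n x~y (sym u~v))
... | tri> _ _ y<x | tri< u<v _ _ =
  trans (window-comm x y u) (trans (ordered y x u v y<x u<v x<n v<n (sym x~y) u~v) (window-comm y x v))
... | tri> _ _ y<x | tri> _ _ v<u =
  trans (window-comm x y u) (trans (sym (ordered y x v u y<x v<u x<n u<n (sym x~y) (sym u~v))) (window-comm y x v))

lastBelow : (ℕ → Bool) → ℕ → ℕ
lastBelow P zero    = zero
lastBelow P (suc m) = if P m then m else lastBelow P m

lastBelow-found : ∀ P m u → u < m → T (P u) → lastBelow P m < m × T (P (lastBelow P m))
lastBelow-found P (suc m) u u<1+m pu with P m in Pm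
... | true  = n<1+n m , subst T (sym Pm) tt
... | false with m≤n⇒m<n∨m≡n (≤-pred u<1+m)
...   | inj₁ u<m  = let (l<m , pl) = lastBelow-found P m u u<m pu in <-trans l<m (n<1+n m) , pl
...   | inj₂ refl = ⊥-elim (subst T Pm pu)

lastBelow-greatest : ∀ P m v → v < m → T (P v) → v ≤ lastBelow P m
lastBelow-greatest P (suc m) v v<1+m pv with P m in Pm
... | true  = ≤-pred v<1+m
... | false with m≤n⇒m<n∨m≡n (≤-pred v<1+m)
...   | inj₁ v<m  = lastBelow-greatest P m v v<m pv
...   | inj₂ refl = ⊥-elim (subst T Pm pv)

module _ (n : ℕ) (γ δ : RawPart) (γ-ncp : NCP n γ) (δ-ncp : NCP n δ) (γ≤δ : Refines n γ δ) where

  private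
    K J : RawPart
    K = kreweras n γ δ
    J = joinNC n γ K
    module Pγ = IsPartition (NCP⇒partition γ γ-ncp)
    module Pδ = IsPartition (NCP⇒partition δ δ-ncp)

    -- b′ is the predecessor of b = min (γ-block of x) in its δ-block, and M = max (γ-block of x);
    -- the window (b′, M] is a union of γ-blocks, so b′ and M are related by K.
    module Descent (x : ℕ) (x<n : x < n) (δ-min<γ-min : at δ x < at γ x) where
      b : ℕ
      b = at γ x
      b<n : b < n
      b<n = Pγ.at< x<n
      b≤x : b ≤ x
      b≤x = Pγ.at≤ x<n
      x~γb : Same γ x b
      x~γb = Pγ.Same-at x<n
      b~δx : Same δ b x
      b~δx = γ≤δ b x b<n x<n (sym x~γb)

      b′ : ℕ
      b′ = lastBelow (λ u → same δ u b) b
      b′-found : b′ < b × T (same δ b′ b)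
      b′-found = lastBelow-found (λ u → same δ u b) b (at δ x) δ-min<γ-min
                   (same⁺ δ (trans (Pδ.at-idem x<n) (sym b~δx)))
      b′<b : b′ < b
      b′<b = proj₁ b′-found
      b′~δb : Same δ b′ b
      b′~δb = same⁻ δ (proj₂ b′-found)
      b′<x : b′ < x
      b′<x = <-≤-trans b′<b b≤x
      b′<n : b′ < n
      b′<n = <-trans b′<x x<n

      M : ℕ
      M = lastBelow (λ u → same γ u x) n
      M-found : M < n × T (same γ M x)
      M-found = lastBelow-found (λ u → same γ u x) n x x<n (same⁺ γ refl)
      M<n : M < n
      M<n = proj₁ M-found
      M~γx : Same γ M x
      M~γx = same⁻ γ (proj₂ M-found)
      x≤M : x ≤ M
      x≤M = lastBelow-greatest (λ u → same γ u x) n x x<n (same⁺ γ refl)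
      b′<M : b′ < M
      b′<M = <-≤-trans b′<x x≤M

      γ-block-of-x : ∀ v → v < n → Same γ v b → b′ < v × v ≤ M
      γ-block-of-x v v<n s =
        <-≤-trans b′<b (subst (_≤ v) (Pγ.at-idem x<n) (Pγ.at≤-block v<n s)) ,
        lastBelow-greatest _ n v v<n (same⁺ γ (trans s (sym x~γb)))

      window-closed : ∀ u v → u < n → v < n → Same γ u v → b′ < u → u ≤ M → b′ < v × v ≤ M
      window-closed u v u<n v<n s b′<u u≤M with <-cmp u b
      ... | tri< u<b _ _ =
        let u≁δb : ¬ T (same δ u b)
            u≁δb u~b = <⇒≱ b′<u (lastBelow-greatest _ b u u<b u~b)
            (b′<v , v<b) = block-inside-arc (same-isEquivalenceᵇ δ) (NCP⇒noncrossing δ δ-ncp) b′<u u<b b<n v<n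
                             (same⁺ δ b′~δb) (λ u~b′ → u≁δb (same⁺ δ (trans (same⁻ δ u~b′) b′~δb)))
                             (same⁺ δ (γ≤δ u v u<n v<n s))
        in b′<v , <⇒≤ (<-≤-trans v<b (≤-trans b≤x x≤M))
      ... | tri≈ _ refl _ = γ-block-of-x v v<n (sym s)
      ... | tri> _ _ b<u with T? (same γ u b)
      ...   | yes u~b = γ-block-of-x v v<n (trans (sym s) (same⁻ γ u~b))
      ...   | no  u≁b =
        let b~γM = same⁺ γ (trans (sym x~γb) (sym M~γx))
            u<M = ≤∧≢⇒< u≤M λ { refl → u≁b (symᵇ (same-isEquivalenceᵇ γ) b u b~γM) }
            (b<v , v<M) = block-inside-arc (same-isEquivalenceᵇ γ) (NCP⇒noncrossing γ γ-ncp) b<u u<M M<n v<n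
                            b~γM u≁b (same⁺ γ s)
        in <-trans b′<b b<v , <⇒≤ v<M

      b′~KM : Same K b′ M
      b′~KM = Same-kreweras⁺ n γ δ b′ M b′<n M<n
        (trans b′~δb (trans b~δx (sym (γ≤δ M x M<n x<n M~γx))))
        (BlockConstant-window γ b′ M b′<M window-closed)

      x~Jb′ : Same J x b′
      x~Jb′ = sym (trans (join-upperʳ n γ K b′ M b′<n M<n b′~KM) (join-upperˡ n γ K M x M<n x<n M~γx))

      δ-min-b′ : at δ b′ ≡ at δ x
      δ-min-b′ = trans b′~δb b~δx

  joined-to-δ-min : ∀ x → x < n → Same J x (at δ x)
  joined-to-δ-min = <-rec (λ x → x < n → Same J x (at δ x)) step
    where
      step : ∀ x → (∀ {y} → y < x → y < n → Same J y (at δ y)) → x < n → Same J x (at δ x)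
      step x IH x<n with m≤n⇒m<n∨m≡n (Pδ.at≤-block (Pγ.at< x<n) (γ≤δ _ x (Pγ.at< x<n) x<n (sym (Pγ.Same-at x<n))))
      ... | inj₂ δ-min≡γ-min = join-upperˡ n γ K x (at δ x) x<n (Pδ.at< x<n)
                                 (subst (Same γ x) (sym δ-min≡γ-min) (Pγ.Same-at x<n))
      ... | inj₁ δ-min<γ-min = trans x~Jb′ (trans (IH b′<x b′<n) (cong (at J) δ-min-b′))
        where open Descent x x<n δ-min<γ-min

  join-kreweras : joinNC n γ (kreweras n γ δ) ≡ δ
  join-kreweras = partition-ext (∧-projˡ (join-NCP n γ K)) (∧-projˡ δ-ncp)
    (join-least n γ K δ δ-ncp γ≤δ (λ x y x<n y<n → proj₁ ∘ Same-kreweras⁻ n γ δ x y x<n y<n))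
    (λ i j i<n j<n s → trans (joined-to-δ-min i i<n) (trans (cong (at J) s) (sym (joined-to-δ-min j j<n))))

module _ (n : ℕ) (γ β : RawPart) (γ-ncp : NCP n γ) (β-ncp : NCP n β) (adm : AdmissiblePair n γ β) where

  private
    δ : RawPart
    δ = joinNC n γ β
    module Pβ = IsPartition (NCP⇒partition β β-ncp)

    Respects : ℕ → ℕ → Bool
    Respects = respectsWindow n γ

    W : IsEquivalenceᵇ Respects
    W = respectsWindow-isEquivalenceᵇ n γ

    β-related⇒Respects : ∀ x y → x < n → y < n → Same β x y → T (Respects x y)
    β-related⇒Respects x y x<n y<n = respectsWindow⁺ n γ x y ∘ adm x y x<n y<n

    -- p is the last point before m₀ = min (β-block of z) whose window to z is a union of γ-blocks,
    -- and M = max (β-block of z); then (p, M] is a union of γ-blocks and of β-blocks.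
    module Separator (z w : ℕ) (z<n : z < n) (w<m₀ : w < at β z) (wz : T (Respects w z)) where
      m₀ : ℕ
      m₀ = at β z
      m₀≤z : m₀ ≤ z
      m₀≤z = Pβ.at≤ z<n
      m₀~βz : Same β m₀ z
      m₀~βz = sym (Pβ.Same-at z<n)

      p : ℕ
      p = lastBelow (λ u → Respects u z) m₀
      p-found : p < m₀ × T (Respects p z)
      p-found = lastBelow-found (λ u → Respects u z) m₀ w w<m₀ wz
      p<m₀ : p < m₀
      p<m₀ = proj₁ p-found
      p<z : p < z
      p<z = <-≤-trans p<m₀ m₀≤z

      M : ℕ
      M = lastBelow (λ u → same β u z) n
      M-found : M < n × T (same β M z)
      M-found = lastBelow-found (λ u → same β u z) n z z<n (same⁺ β refl)
      M<n : M < n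
      M<n = proj₁ M-found
      M~βz : Same β M z
      M~βz = same⁻ β (proj₂ M-found)
      z≤M : z ≤ M
      z≤M = lastBelow-greatest (λ u → same β u z) n z z<n (same⁺ β refl)
      p<M : p < M
      p<M = <-≤-trans p<z z≤M

      pM : T (Respects p M)
      pM = transᵇ W p z M (proj₂ p-found) (β-related⇒Respects z M z<n M<n (sym M~βz))

      β-block-of-z : ∀ v → v < n → Same β v z → p < v × v ≤ M
      β-block-of-z v v<n s = <-≤-trans p<m₀ (Pβ.at≤-block v<n s) , lastBelow-greatest _ n v v<n (same⁺ β s)

      window-closed : ∀ u v → u < n → v < n → Same β u v → p < u → u ≤ M → p < v × v ≤ M
      window-closed u v u<n v<n s p<u u≤M with <-cmp u m₀
      ... | tri< u<m₀ _ _ =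
        let u≁z : ¬ T (Respects u z)
            u≁z uz = <⇒≱ p<u (lastBelow-greatest _ m₀ u u<m₀ uz)
            (p<v , v<M) = block-inside-arc W (respectsWindow-noncrossing n γ) p<u (<-≤-trans u<m₀ (≤-trans m₀≤z z≤M))
                            M<n v<n pM (λ up → u≁z (transᵇ W u p z up (proj₂ p-found)))
                            (β-related⇒Respects u v u<n v<n s)
        in p<v , <⇒≤ v<M
      ... | tri≈ _ refl _ = β-block-of-z v v<n (trans (sym s) m₀~βz)
      ... | tri> _ _ m₀<u with T? (same β u z)
      ...   | yes u~z = β-block-of-z v v<n (trans (sym s) (same⁻ β u~z))
      ...   | no  u≁z =
        let m₀~βM = same⁺ β (trans m₀~βz (sym M~βz))
            u<M = ≤∧≢⇒< u≤M λ { refl → u≁z (same⁺ β M~βz) }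
            (m₀<v , v<M) = block-inside-arc (same-isEquivalenceᵇ β) (NCP⇒noncrossing β β-ncp) m₀<u u<M M<n v<n
                             m₀~βM (λ um₀ → u≁z (same⁺ β (trans (same⁻ β um₀) m₀~βz))) (same⁺ β s)
        in <-trans p<m₀ m₀<v , <⇒≤ v<M

      δ-respects : BlockConstant n δ (window p M)
      δ-respects = BlockConstant-join γ β p M (respectsWindow⁻ n γ p M pM) (BlockConstant-window β p M p<M window-closed)

      z-inside : window p M z ≡ true
      z-inside = window-inside p<z z≤M

    -- If x < y were δ-related with a γ-respected window but in different β-blocks, a Separator
    -- window would contain exactly one of them.
    β-related-< : ∀ x y → x < y → y < n → Same δ x y → T (Respects x y) → Same β x y
    β-related-< x y x<y y<n x~δy xy with T? (same β x y)
    ... | yes x~βy = same⁻ β x~βy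
    ... | no  x≁βy with <-cmp x (at β y)
    ...   | tri≈ _ refl _ = ⊥-elim (x≁βy (same⁺ β (Pβ.at-idem y<n)))
    ...   | tri< x<m₀ _ _ = ⊥-elim (true≢false (begin
      true           ≡⟨ z-inside ⟨
      window p M y   ≡⟨ δ-respects x y x<n y<n x~δy ⟨
      window p M x   ≡⟨ window-below (<⇒≤ p<M) (lastBelow-greatest _ (at β y) x x<m₀ xy) ⟩
      false          ∎))
      where
        open ≡-Reasoning
        x<n : x < n
        x<n = <-trans x<y y<n
        open Separator y x y<n x<m₀ xy
    ...   | tri> _ _ z₁<x = ⊥-elim (true≢false (begin
      true           ≡⟨ z-inside ⟨
      window p M x   ≡⟨ δ-respects x y x<n y<n x~δy ⟩
      window p M y   ≡⟨ window-above (<⇒≤ p<M) M<y ⟩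
      false          ∎))
      where
        open ≡-Reasoning
        x<n : x < n
        x<n = <-trans x<y y<n
        z₁ : ℕ
        z₁ = at β y
        z₁~βy : T (same β z₁ y)
        z₁~βy = same⁺ β (Pβ.at-idem y<n)
        x≁βz₁ : ¬ T (same β x z₁)
        x≁βz₁ xz₁ = x≁βy (same⁺ β (trans (same⁻ β xz₁) (same⁻ β z₁~βy)))
        β-block-of-x-inside : ∀ {v} → v < n → Same β x v → z₁ < v × v < y
        β-block-of-x-inside v<n s = block-inside-arc (same-isEquivalenceᵇ β) (NCP⇒noncrossing β β-ncp)
          z₁<x x<y y<n v<n z₁~βy x≁βz₁ (same⁺ β s)
        z₁x : T (Respects z₁ x)
        z₁x = transᵇ W z₁ y x (β-related⇒Respects z₁ y (Pβ.at< y<n) y<n (same⁻ β z₁~βy)) (symᵇ W x y xy)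
        open Separator x z₁ x<n (proj₁ (β-block-of-x-inside (Pβ.at< x<n) (Pβ.Same-at x<n))) z₁x
        M<y : M < y
        M<y = proj₂ (β-block-of-x-inside M<n (sym M~βz))

  kreweras-join : kreweras n γ (joinNC n γ β) ≡ β
  kreweras-join = partition-ext (∧-projˡ (kreweras-NCP n γ δ (join-NCP n γ β))) (∧-projˡ β-ncp)
    (λ x y x<n y<n s → let (x~δy , c) = Same-kreweras⁻ n γ δ x y x<n y<n s in
       β-related x y x<n y<n x~δy (respectsWindow⁺ n γ x y c))
    (λ x y x<n y<n s → Same-kreweras⁺ n γ δ x y x<n y<n (join-upperʳ n γ β x y x<n y<n s) (adm x y x<n y<n s))
    where
      β-related : ∀ x y → x < n → y < n → Same δ x y → T (Respects x y) → Same β x y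
      β-related x y x<n y<n x~δy xy with <-cmp x y
      ... | tri< x<y _ _ = β-related-< x y x<y y<n x~δy xy
      ... | tri≈ _ refl _ = refl
      ... | tri> _ _ y<x = sym (β-related-< y x y<x x<n (sym x~δy) (symᵇ W x y xy))

-- Perfect shuffles

-- 0-indexed form of the paper's position k(x-1)+i of element x of the i-th factor in a k-fold shuffle.
slot : ℕ → ℕ → ℕ → ℕ
slot k x r = r + x * k

module _ {k : ℕ} .{{_ : NonZero k}} where

  slot-div : ∀ x {r} → r < k → slot k x r / k ≡ x
  slot-div x {r} r<k = trans (+-distrib-/-∣ʳ r (n∣m*n x)) (cong₂ _+_ (m<n⇒m/n≡0 r<k) (m*n/n≡m x k))

  slot-mod : ∀ x {r} → r < k → slot k x r % k ≡ r
  slot-mod x {r} r<k = trans ([m+kn]%n≡m%n r x k) (m<n⇒m%n≡m r<k)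

  slot-div-mod : ∀ p → p ≡ slot k (p / k) (p % k)
  slot-div-mod p = m≡m%n+[m/n]*n p k

  slot-< : ∀ {n x r} → r < k → x < n → slot k x r < k * n
  slot-< {n} {x} r<k x<n =
    <-≤-trans (+-monoˡ-< (x * k) r<k) (subst (suc x * k ≤_) (*-comm n k) (*-monoˡ-≤ k x<n))

div-< : ∀ {k n p} .{{_ : NonZero k}} → p < k * n → p / k < n
div-< {k} {n} {p} p<kn = m<n*o⇒m/o<n (subst (p <_) (*-comm k n) p<kn)

slot-<-group : ∀ {k x y r r′} → r < k → x < y → slot k x r < slot k y r′
slot-<-group {k} {x} {y} {r} {r′} r<k x<y =
  <-≤-trans (+-monoˡ-< (x * k) r<k) (≤-trans (*-monoˡ-≤ k x<y) (m≤n+m (y * k) r′))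

slot-<-lex : ∀ {k x y r r′} → r < r′ → r < k → x ≤ y → slot k x r < slot k y r′
slot-<-lex {k} {x} r<r′ r<k x≤y with m≤n⇒m<n∨m≡n x≤y
... | inj₁ x<y  = slot-<-group r<k x<y
... | inj₂ refl = +-monoˡ-< (x * k) r<r′

slot-<⇒group-≤ : ∀ {k x y r r′} → r′ < k → slot k x r < slot k y r′ → x ≤ y
slot-<⇒group-≤ r′<k lt = ≮⇒≥ λ y<x → <-asym lt (slot-<-group r′<k y<x)

slot-<⇒group-< : ∀ {k x y r r′} → r′ ≤ r → r′ < k → slot k x r < slot k y r′ → x < y
slot-<⇒group-< {k} {x} {y} {r} {r′} r′≤r r′<k lt with m≤n⇒m<n∨m≡n (slot-<⇒group-≤ {k} {x} {y} {r} r′<k lt)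
... | inj₁ x<y  = x<y
... | inj₂ refl = ⊥-elim (<⇒≱ (+-cancelʳ-< (x * k) r r′ lt) r′≤r)

All-atL : ∀ {P : RawPart → Set} {l} → All P l → ∀ i → i < length l → P (atL l i)
All-atL (p ∷ _)  zero    _         = p
All-atL (_ ∷ ps) (suc i) (s<s i<l) = All-atL ps i i<l

All-atL⁺ : ∀ {P : RawPart → Set} l → (∀ i → i < length l → P (atL l i)) → All P l
All-atL⁺ []      _ = []
All-atL⁺ (a ∷ l) h = h 0 z<s ∷ All-atL⁺ l (λ i i<l → h (suc i) (s<s i<l))

AllPairs-atL : ∀ {R : RawPart → RawPart → Set} {l} → AllPairs R l →
  ∀ i j → i < j → j < length l → R (atL l i) (atL l j)
AllPairs-atL (r ∷ _)  zero    (suc j) _         (s<s j<l) = All-atL r j j<l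
AllPairs-atL (_ ∷ rs) (suc i) (suc j) (s<s i<j) (s<s j<l) = AllPairs-atL rs i j i<j j<l

AllPairs-atL⁺ : ∀ {R : RawPart → RawPart → Set} l →
  (∀ i j → i < j → j < length l → R (atL l i) (atL l j)) → AllPairs R l
AllPairs-atL⁺ []      _ = []
AllPairs-atL⁺ (a ∷ l) h = All-atL⁺ l (λ j j<l → h 0 (suc j) z<s (s<s j<l))
                        ∷ AllPairs-atL⁺ l (λ i j i<j j<l → h (suc i) (suc j) (s<s i<j) (s<s j<l))

module Shuffle (n : ℕ) (α : RawPart) (rest : List RawPart) where

  factors : List RawPart
  factors = α ∷ rest

  arity : ℕ
  arity = suc (length rest)

  shuffleRel : ℕ → ℕ → Bool
  shuffleRel p q = ((p % arity) ≡ᵇ (q % arity)) ∧ same (atL factors (p % arity)) (p / arity) (q / arity)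

  shuffleRel-isEquivalenceᵇ : IsEquivalenceᵇ shuffleRel
  shuffleRel-isEquivalenceᵇ = record
    { reflᵇ  = λ p → ∧-intro (≡⇒≡ᵇ (p % arity) _ refl) (same⁺ (factor p) refl)
    ; symᵇ   = λ p q h → let p≡q = residue-≡ p q h in
        ∧-intro (≡⇒≡ᵇ _ _ (sym p≡q)) (same⁺ (factor q) (sym (blocks p q q (sym p≡q) h)))
    ; transᵇ = λ p q r h h′ → let p≡q = residue-≡ p q h in
        ∧-intro (≡⇒≡ᵇ _ _ (trans p≡q (residue-≡ q r h′)))
                (same⁺ (factor p) (trans (blocks p q p refl h) (blocks q r p p≡q h′)))
    }
    where
      factor : ℕ → RawPart
      factor p = atL factors (p % arity)
      residue-≡ : ∀ p q → T (shuffleRel p q) → p % arity ≡ q % arity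
      residue-≡ p q h = ≡ᵇ⇒≡ _ _ (∧-projˡ h)
      blocks : ∀ p q r → r % arity ≡ p % arity → T (shuffleRel p q) → Same (factor r) (p / arity) (q / arity)
      blocks p q r r≡p h = subst (λ i → Same (atL factors i) (p / arity) (q / arity)) (sym r≡p)
        (same⁻ (factor p) (∧-projʳ ((p % arity) ≡ᵇ (q % arity)) h))

  sh : RawPart
  sh = shuffle n factors

  Same-shuffle⁻ : ∀ p q → p < arity * n → q < arity * n → Same sh p q →
    p % arity ≡ q % arity × Same (atL factors (p % arity)) (p / arity) (q / arity)
  Same-shuffle⁻ p q p< q< s = let h = Same-canon⁻ shuffleRel-isEquivalenceᵇ p q p< q< s in
    ≡ᵇ⇒≡ _ _ (∧-projˡ h) , same⁻ (atL factors (p % arity)) (∧-projʳ ((p % arity) ≡ᵇ (q % arity)) h)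

  Same-shuffle⁺ : ∀ p q → p < arity * n → q < arity * n → p % arity ≡ q % arity →
    Same (atL factors (p % arity)) (p / arity) (q / arity) → Same sh p q
  Same-shuffle⁺ p q p< q< e s =
    Same-canon⁺ shuffleRel-isEquivalenceᵇ p q p< q< (∧-intro (≡⇒≡ᵇ _ _ e) (same⁺ (atL factors (p % arity)) s))

  Same-slot⁺ : ∀ {r x y} → r < arity → x < n → y < n → Same (atL factors r) x y →
    Same sh (slot arity x r) (slot arity y r)
  Same-slot⁺ {r} {x} {y} r< x<n y<n s =
    Same-shuffle⁺ _ _ (slot-< r< x<n) (slot-< r< y<n) (trans (slot-mod x r<) (sym (slot-mod y r<)))
      (subst₂ (λ i z → Same (atL factors i) z (slot arity y r / arity)) (sym (slot-mod x r<)) (sym (slot-div x r<))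
        (subst (Same (atL factors r) x) (sym (slot-div y r<)) s))

  Same-slot⇒residue-≡ : ∀ {r r′ x y} → r < arity → r′ < arity → x < n → y < n →
    Same sh (slot arity x r) (slot arity y r′) → r ≡ r′
  Same-slot⇒residue-≡ {x = x} {y} r< r′< x<n y<n s =
    trans (sym (slot-mod x r<)) (trans (proj₁ (Same-shuffle⁻ _ _ (slot-< r< x<n) (slot-< r′< y<n) s)) (slot-mod y r′<))

  shuffle-below-inflation : ∀ ρ → (∀ r → r < arity → Refines n (atL factors r) ρ) →
    ∀ p q → p < arity * n → q < arity * n → Same sh p q → Same ρ (p / arity) (q / arity)
  shuffle-below-inflation ρ below p q p< q< s =
    let (_ , s′) = Same-shuffle⁻ p q p< q< s
    in below (p % arity) (m%n<n p arity) _ _ (div-< p<) (div-< q<) s′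


  group-< : ∀ {p q} → p < q → q % arity ≤ p % arity → p / arity < q / arity
  group-< {p} {q} p<q q≤p = slot-<⇒group-< {arity} {p / arity} {q / arity} {p % arity} q≤p (m%n<n q arity)
    (subst₂ _<_ (slot-div-mod p) (slot-div-mod q) p<q)

  module _ (sh-nc : Noncrossing (arity * n) (same sh)) where

    interleaving-absurd : ∀ {r r′ x y u v} → r < arity → r′ < arity → r ≢ r′ → y < n → v < n →
      Same (atL factors r) x y → Same (atL factors r′) u v →
      slot arity x r < slot arity u r′ → slot arity u r′ < slot arity y r → slot arity y r < slot arity v r′ → ⊥
    interleaving-absurd {r} {r′} {x} {y} {u} {v} r< r′< r≢r′ y<n v<n x~y u~v xu uy yv =
      r≢r′ (Same-slot⇒residue-≡ r< r′< x<n u<n (same⁻ sh crossing))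
      where
        x<n : x < n
        x<n = <-trans (slot-<⇒group-< {arity} {x} {y} {r} ≤-refl r< (<-trans xu uy)) y<n
        u<n : u < n
        u<n = <-trans (slot-<⇒group-< {arity} {u} {v} {r′} ≤-refl r′< (<-trans uy yv)) v<n
        crossing : T (same sh (slot arity x r) (slot arity u r′))
        crossing = sh-nc _ _ _ _ xu uy yv (slot-< r′< v<n)
                     (same⁺ sh (Same-slot⁺ r< x<n y<n x~y)) (same⁺ sh (Same-slot⁺ r′< u<n v<n u~v))

    factors-admissible : ∀ i j → i < j → j < arity → AdmissiblePair n (atL factors i) (atL factors j)
    factors-admissible i j i<j j< = AdmissiblePair-from-ordered (atL factors i) (atL factors j) ordered
      where
        i< : i < arity
        i< = <-trans i<j j<
        ordered : ∀ x y u v → x < y → u < v → y < n → v < n → Same (atL factors j) x y →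
                  Same (atL factors i) u v → window x y u ≡ window x y v
        ordered x y u v x<y u<v y<n v<n x~y u~v with (x <? u) ×-dec (u ≤? y) | (x <? v) ×-dec (v ≤? y)
        ... | yes (x<u , u≤y) | yes (x<v , v≤y) = trans (window-inside x<u u≤y) (sym (window-inside x<v v≤y))
        ... | no u-out | no v-out = trans (window-outside x<y u-out) (sym (window-outside x<y v-out))
        ... | yes (x<u , u≤y) | no v-out = ⊥-elim (interleaving-absurd j< i< (≢-sym (<⇒≢ i<j)) y<n v<n x~y u~v
              (slot-<-group j< x<u) (slot-<-lex i<j i< u≤y) (slot-<-group j< y<v))
          where
            y<v : y < v
            y<v = ≰⇒> λ v≤y → v-out (<-trans x<u u<v , v≤y)
        ... | no u-out | yes (x<v , v≤y) = ⊥-elim (interleaving-absurd i< j< (<⇒≢ i<j) v<n y<n u~v x~y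
              (slot-<-lex i<j i< u≤x) (slot-<-group j< x<v) (slot-<-lex i<j i< v≤y))
          where
            u≤x : u ≤ x
            u≤x = ≮⇒≥ λ x<u → u-out (x<u , <⇒≤ (<-≤-trans u<v v≤y))

  shuffle-noncrossing : (∀ r → r < arity → NCP n (atL factors r)) →
    (∀ i j → i < j → j < arity → AdmissiblePair n (atL factors i) (atL factors j)) →
    Noncrossing (arity * n) (same sh)
  shuffle-noncrossing ncp adm a b c d ab bc cd d<N ac bd =
    by-residues (Same-shuffle⁻ a c a<N c<N (same⁻ sh ac)) (Same-shuffle⁻ b d b<N d<N (same⁻ sh bd))
                (<-cmp (a % arity) (b % arity))
    where
      c<N : c < arity * n
      c<N = <-trans cd d<N
      b<N : b < arity * n
      b<N = <-trans bc c<N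
      a<N : a < arity * n
      a<N = <-trans ab b<N
      open ≡-Reasoning

      by-residues : a % arity ≡ c % arity × Same (atL factors (a % arity)) (a / arity) (c / arity) →
                    b % arity ≡ d % arity × Same (atL factors (b % arity)) (b / arity) (d / arity) →
                    Tri (a % arity < b % arity) (a % arity ≡ b % arity) (b % arity < a % arity) →
                    T (same sh a b)
      by-residues (a≡c , a~c) (b≡d , b~d) (tri≈ _ a≡b _) =
        same⁺ sh (Same-shuffle⁺ a b a<N b<N a≡b (same⁻ (atL factors (a % arity))
          (NCP⇒noncrossing factor (ncp _ (m%n<n a arity)) _ _ _ _
            (group-< ab (≤-reflexive (sym a≡b)))
            (group-< bc (≤-reflexive (trans (sym a≡c) a≡b)))
            (group-< cd (≤-reflexive (trans (sym b≡d) (trans (sym a≡b) a≡c))))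
            (div-< d<N) (same⁺ factor a~c)
            (same⁺ factor (subst (λ r → Same (atL factors r) (b / arity) (d / arity)) (sym a≡b) b~d)))))
        where
          factor : RawPart
          factor = atL factors (a % arity)
      by-residues (a≡c , a~c) (b≡d , b~d) (tri< ra<rb _ _) = ⊥-elim (true≢false (begin
        true                                       ≡⟨ window-inside (group-< bc (<⇒≤ (subst (_< b % arity) a≡c ra<rb)))
                                                                    (/-monoˡ-≤ arity (<⇒≤ cd)) ⟨
        window (b / arity) (d / arity) (c / arity) ≡⟨ respects _ _ (div-< a<N) (div-< c<N) a~c ⟨
        window (b / arity) (d / arity) (a / arity) ≡⟨ window-below (/-monoˡ-≤ arity (<⇒≤ (<-trans bc cd)))
                                                                   (/-monoˡ-≤ arity (<⇒≤ ab)) ⟩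
        false                                      ∎))
        where
          respects : BlockConstant n (atL factors (a % arity)) (window (b / arity) (d / arity))
          respects = adm (a % arity) (b % arity) ra<rb (m%n<n b arity) _ _ (div-< b<N) (div-< d<N) b~d
      by-residues (a≡c , a~c) (b≡d , b~d) (tri> _ _ rb<ra) = ⊥-elim (true≢false (begin
        true                                       ≡⟨ window-inside (group-< ab (<⇒≤ rb<ra)) (/-monoˡ-≤ arity (<⇒≤ bc)) ⟨
        window (a / arity) (c / arity) (b / arity) ≡⟨ respects _ _ (div-< b<N) (div-< d<N) b~d ⟩
        window (a / arity) (c / arity) (d / arity) ≡⟨ window-above (/-monoˡ-≤ arity (<⇒≤ (<-trans ab bc)))
                                                                   (group-< cd (<⇒≤ (subst₂ _<_ b≡d a≡c rb<ra))) ⟩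
        false                                      ∎))
        where
          respects : BlockConstant n (atL factors (b % arity)) (window (a / arity) (c / arity))
          respects = adm (b % arity) (a % arity) rb<ra (m%n<n a arity) _ _ (div-< a<N) (div-< c<N) a~c

  admissible⇒AllPairs : T (admissible n factors) → AllPairs (AdmissiblePair n) factors
  admissible⇒AllPairs h = AllPairs-atL⁺ factors (factors-admissible (noncrossing⁻ (arity * n) sh h))

  AllPairs⇒admissible : All (NCP n) factors → AllPairs (AdmissiblePair n) factors → T (admissible n factors)
  AllPairs⇒admissible ncp adm =
    noncrossing⁺ (arity * n) sh (shuffle-noncrossing (All-atL ncp) (AllPairs-atL adm))

-- Composition is join

≡ᵇ-isEquivalenceᵇ : IsEquivalenceᵇ _≡ᵇ_
≡ᵇ-isEquivalenceᵇ = record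
  { reflᵇ  = λ i → ≡⇒≡ᵇ i i refl
  ; symᵇ   = λ i j p → ≡⇒≡ᵇ j i (sym (≡ᵇ⇒≡ i j p))
  ; transᵇ = λ i j k p q → ≡⇒≡ᵇ i k (trans (≡ᵇ⇒≡ i j p) (≡ᵇ⇒≡ j k q))
  }

Same-pairing⁻ : ∀ {n} p q → p < 2 * n → q < 2 * n → Same (pairing n) p q → p / 2 ≡ q / 2
Same-pairing⁻ p q p< q< s = ≡ᵇ⇒≡ _ _ (Same-canon⁻ (pullback-isEquivalenceᵇ (_/ 2) ≡ᵇ-isEquivalenceᵇ) p q p< q< s)

Same-pairing⁺ : ∀ {n} p q → p < 2 * n → q < 2 * n → p / 2 ≡ q / 2 → Same (pairing n) p q
Same-pairing⁺ p q p< q< e = Same-canon⁺ (pullback-isEquivalenceᵇ (_/ 2) ≡ᵇ-isEquivalenceᵇ) p q p< q< (≡⇒≡ᵇ _ _ e)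

odd : ℕ → ℕ
odd x = 2 * x + 1

odd≡slot : ∀ x → odd x ≡ slot 2 x 1
odd≡slot x = trans (+-comm (2 * x) 1) (cong suc (*-comm 2 x))

odd-< : ∀ {n x} → x < n → odd x < 2 * n
odd-< {n} {x} x<n = subst (_< 2 * n) (sym (odd≡slot x)) (slot-< (s<s z<s) x<n)

odd-mono : ∀ {x y} → x ≤ y → odd x ≤ odd y
odd-mono x≤y = +-monoˡ-≤ 1 (*-monoʳ-≤ 2 x≤y)

-- The two factors of a ∗ b sit at the even and odd positions; the pairing glues 2x to 2x+1.
module _ (n : ℕ) (a b : RawPart) where

  private
    open Shuffle n a (b ∷ [])
    J₂ : RawPart
    J₂ = joinNC (2 * n) sh (pairing n)

  factors-below-join : ∀ r → r < 2 → Refines n (atL (a ∷ b ∷ []) r) (joinNC n a b)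
  factors-below-join 0 _ = join-upperˡ n a b
  factors-below-join 1 _ = join-upperʳ n a b
  factors-below-join (suc (suc _)) (s<s (s<s ()))

  odd-Same⇒Same-join : ∀ i j → i < n → j < n → Same J₂ (odd i) (odd j) → Same (joinNC n a b) i j
  odd-Same⇒Same-join i j i<n j<n s = subst₂ (Same ab) (odd/2 i) (odd/2 j)
    (same⁻ ab (join-least-relation (2 * n) sh (pairing n) E nc
      (λ p q p< q< s → same⁺ ab (shuffle-below-inflation ab factors-below-join p q p< q< s))
      (λ p q p< q< s → same⁺ ab (cong (at ab) (Same-pairing⁻ {n} p q p< q< s)))
      (odd i) (odd j) (odd-< i<n) (odd-< j<n) s))
    where
      ab : RawPart
      ab = joinNC n a b
      E : IsEquivalenceᵇ (λ p q → same ab (p / 2) (q / 2))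
      E = pullback-isEquivalenceᵇ (_/ 2) (same-isEquivalenceᵇ ab)
      nc : Noncrossing (2 * n) (λ p q → same ab (p / 2) (q / 2))
      nc = pullback-noncrossing (_/ 2) (same-isEquivalenceᵇ ab) (NCP⇒noncrossing ab (join-NCP n a b))
             (/-monoˡ-≤ 2) div-<
      odd/2 : ∀ x → odd x / 2 ≡ x
      odd/2 x = trans (cong (_/ 2) (odd≡slot x)) (slot-div x (s<s z<s))

  Same-join⇒odd-Same : ∀ i j → i < n → j < n → Same (joinNC n a b) i j → Same J₂ (odd i) (odd j)
  Same-join⇒odd-Same i j i<n j<n s =
    same⁻ J₂ (join-least-relation n a b E nc
      (λ x y x<n y<n s → same⁺ J₂ (begin
        at J₂ (odd x)        ≡⟨ cong (at J₂) (odd≡slot x) ⟩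
        at J₂ (slot 2 x 1)   ≡⟨ glued x<n ⟨
        at J₂ (slot 2 x 0)   ≡⟨ join-upperˡ (2 * n) sh (pairing n) _ _ (slot-< z<s x<n) (slot-< z<s y<n)
                                  (Same-slot⁺ z<s x<n y<n s) ⟩
        at J₂ (slot 2 y 0)   ≡⟨ glued y<n ⟩
        at J₂ (slot 2 y 1)   ≡⟨ cong (at J₂) (odd≡slot y) ⟨
        at J₂ (odd y)        ∎))
      (λ x y x<n y<n s → same⁺ J₂ (subst₂ (Same J₂) (sym (odd≡slot x)) (sym (odd≡slot y))
        (join-upperˡ (2 * n) sh (pairing n) _ _ (slot-< (s<s z<s) x<n) (slot-< (s<s z<s) y<n)
          (Same-slot⁺ (s<s z<s) x<n y<n s))))
      i j i<n j<n s)
    where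
      open ≡-Reasoning
      E : IsEquivalenceᵇ (λ x y → same J₂ (odd x) (odd y))
      E = pullback-isEquivalenceᵇ odd (same-isEquivalenceᵇ J₂)
      nc : Noncrossing n (λ x y → same J₂ (odd x) (odd y))
      nc = pullback-noncrossing odd (same-isEquivalenceᵇ J₂) (NCP⇒noncrossing J₂ (join-NCP (2 * n) sh (pairing n)))
             odd-mono odd-<
      glued : ∀ {x} → x < n → Same J₂ (slot 2 x 0) (slot 2 x 1)
      glued {x} x<n = join-upperʳ (2 * n) sh (pairing n) _ _ (slot-< z<s x<n) (slot-< (s<s z<s) x<n)
        (Same-pairing⁺ {n} _ _ (slot-< z<s x<n) (slot-< (s<s z<s) x<n)
          (trans (slot-div x z<s) (sym (slot-div x (s<s z<s)))))

  compose≡join : compose n a b ≡ joinNC n a b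
  compose≡join = canon-cong n _ _ λ i j i<n j<n → T-ext
    (Same-join⁻ n a b i j i<n j<n ∘ odd-Same⇒Same-join i j i<n j<n ∘ same⁻ J₂)
    (same⁺ J₂ ∘ Same-join⇒odd-Same i j i<n j<n ∘ Same-join⁺ n a b i j i<n j<n)


-- Partial joins and complements

module _ (n : ℕ) where

  partialJoins : ∀ {m} → RawPart → Vec RawPart m → Vec RawPart m
  partialJoins p []       = []
  partialJoins p (b ∷ bs) = joinNC n p b ∷ partialJoins (joinNC n p b) bs

  toChain : ∀ {m} → Vec RawPart (suc m) → Vec RawPart (suc m)
  toChain (a ∷ as) = a ∷ partialJoins a as

  complements : ∀ {m} → RawPart → Vec RawPart m → Vec RawPart m
  complements p []       = []
  complements p (y ∷ ys) = kreweras n p y ∷ complements y ys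

  fromChain : ∀ {m} → Vec RawPart (suc m) → Vec RawPart (suc m)
  fromChain (x ∷ xs) = x ∷ complements x xs

  BarSimplex : ∀ {m} → Vec RawPart m → Set
  BarSimplex αs = T (allB (isNCP n) αs ∧ admissible n (toList αs))

  NerveSimplex : ∀ {m} → Vec RawPart m → Set
  NerveSimplex xs = T (allB (isNCP n) xs ∧ chain n xs)

  allB⁻ : ∀ {m} (v : Vec RawPart m) → T (allB (isNCP n) v) → All (NCP n) (toList v)
  allB⁻ []      _ = []
  allB⁻ (a ∷ v) h = ∧-projˡ h ∷ allB⁻ v (∧-projʳ (isNCP n a) h)

  allB⁺ : ∀ {m} (v : Vec RawPart m) → All (NCP n) (toList v) → T (allB (isNCP n) v)
  allB⁺ []      _        = tt
  allB⁺ (a ∷ v) (h ∷ hs) = ∧-intro h (allB⁺ v hs)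

  AdmissiblePair-join : ∀ a b c → AdmissiblePair n a c → AdmissiblePair n b c → AdmissiblePair n (joinNC n a b) c
  AdmissiblePair-join a b c ac bc x y x<n y<n s = BlockConstant-join a b x y (ac x y x<n y<n s) (bc x y x<n y<n s)

  AdmissiblePair-kreweras : ∀ e γ δ → Refines n e γ → AdmissiblePair n e (kreweras n γ δ)
  AdmissiblePair-kreweras e γ δ e≤γ x y x<n y<n s =
    BlockConstant-refines {n} {e} {γ} e≤γ (proj₂ (Same-kreweras⁻ n γ δ x y x<n y<n s))

  partialJoins-chain : ∀ {m} p (bs : Vec RawPart m) → NCP n p → NerveSimplex (p ∷ partialJoins p bs)
  partialJoins-chain p []       p-ncp = ∧-intro (∧-intro p-ncp tt) tt
  partialJoins-chain p (b ∷ bs) p-ncp =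
    let rest = partialJoins-chain (joinNC n p b) bs (join-NCP n p b)
    in ∧-intro (∧-intro p-ncp (∧-projˡ rest))
               (∧-intro (refines⁺ n p (joinNC n p b) (join-upperˡ n p b)) (∧-projʳ (allB (isNCP n) (partialJoins p (b ∷ bs))) rest))

  complements-NCP : ∀ {m} p (ys : Vec RawPart m) → T (allB (isNCP n) ys) → All (NCP n) (toList (complements p ys))
  complements-NCP p []       _ = []
  complements-NCP p (y ∷ ys) h = kreweras-NCP n p y (∧-projˡ h) ∷ complements-NCP y ys (∧-projʳ (isNCP n y) h)

  complements-admissible : ∀ {m} e q (ys : Vec RawPart m) → T (chain n (q ∷ ys)) → Refines n e q →
    All (AdmissiblePair n e) (toList (complements q ys))
  complements-admissible e q []       _  _   = []
  complements-admissible e q (y ∷ ys) ch e≤q =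
    AdmissiblePair-kreweras e q y e≤q ∷
    complements-admissible e y ys (∧-projʳ (refines n q y) ch) (Refines-trans e q y e≤q (refines⁻ n q y (∧-projˡ ch)))

  complements-AllPairs : ∀ {m} q (ys : Vec RawPart m) → T (chain n (q ∷ ys)) →
    AllPairs (AdmissiblePair n) (toList (complements q ys))
  complements-AllPairs q []       _  = []
  complements-AllPairs q (y ∷ ys) ch =
    complements-admissible (kreweras n q y) y ys (∧-projʳ (refines n q y) ch)
      (λ u v u<n v<n → proj₁ ∘ Same-kreweras⁻ n q y u v u<n v<n) ∷
    complements-AllPairs y ys (∧-projʳ (refines n q y) ch)

  complements-partialJoins : ∀ {m} p (bs : Vec RawPart m) → NCP n p → All (NCP n) (toList bs) →
    All (AdmissiblePair n p) (toList bs) → AllPairs (AdmissiblePair n) (toList bs) →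
    complements p (partialJoins p bs) ≡ bs
  complements-partialJoins p []       _     _              _            _              = refl
  complements-partialJoins p (b ∷ bs) p-ncp (b-ncp ∷ ncps) (pb ∷ p-adm) (b-adm ∷ adms) =
    cong₂ _∷_ (kreweras-join n p b p-ncp b-ncp pb)
      (complements-partialJoins (joinNC n p b) bs (join-NCP n p b) ncps (joined p-adm b-adm) adms)
    where
      joined : ∀ {l} → All (AdmissiblePair n p) l → All (AdmissiblePair n b) l → All (AdmissiblePair n (joinNC n p b)) l
      joined []         []         = []
      joined (_∷_ {c} pc pcs) (bc ∷ bcs) = AdmissiblePair-join p b c pc bc ∷ joined pcs bcs

  partialJoins-complements : ∀ {m} p (ys : Vec RawPart m) → NCP n p → T (allB (isNCP n) ys) → T (chain n (p ∷ ys)) →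
    partialJoins p (complements p ys) ≡ ys
  partialJoins-complements p []       _     _   _  = refl
  partialJoins-complements p (y ∷ ys) p-ncp ncps ch =
    let y-ncp = ∧-projˡ ncps
    in trans (cong (λ q → q ∷ partialJoins q (complements y ys)) (join-kreweras n p y p-ncp y-ncp (refines⁻ n p y (∧-projˡ ch))))
             (cong (y ∷_) (partialJoins-complements y ys y-ncp (∧-projʳ (isNCP n y) ncps) (∧-projʳ (refines n p y) ch)))

  partialJoins-face : ∀ {m} p (v : Vec RawPart (suc m)) (i : Fin (suc m)) →
    partialJoins p (barFace n (suc i) v) ≡ removeAt (partialJoins p v) i
  partialJoins-face p (b ∷ [])     zero    = refl
  partialJoins-face p (b ∷ c ∷ cs) zero    =
    cong (λ q → q ∷ partialJoins q cs) (trans (cong (joinNC n p) (compose≡join n b c)) (join-assoc n p b c))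
  partialJoins-face p (b ∷ c ∷ cs) (suc i) = cong (joinNC n p b ∷_) (partialJoins-face (joinNC n p b) (c ∷ cs) i)

  toChain-face : ∀ {m} (i : Fin (suc (suc m))) (v : Vec RawPart (suc (suc m))) →
    toChain (barFace n (suc i) v) ≡ removeAt (toChain v) i
  toChain-face zero    (a ∷ b ∷ as) = cong (λ q → q ∷ partialJoins q as) (compose≡join n a b)
  toChain-face (suc i) (a ∷ b ∷ as) = cong (a ∷_) (partialJoins-face a (b ∷ as) i)

  partialJoins-degen : ∀ {m} p (as : Vec RawPart m) (i : Fin (suc m)) → NCP n p →
    p ∷ partialJoins p (insertAt as i (zeroP n)) ≡
    insertAt (p ∷ partialJoins p as) (inject₁ i) (lookup (p ∷ partialJoins p as) i)
  partialJoins-degen p as       zero    p-ncp = cong (λ q → p ∷ q ∷ partialJoins q as) (join-zeroʳ n p p-ncp)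
  partialJoins-degen p (b ∷ bs) (suc i) p-ncp = cong (p ∷_) (partialJoins-degen (joinNC n p b) bs i (join-NCP n p b))

  toChain-degen : ∀ {m} (i : Fin (suc m)) (v : Vec RawPart (suc m)) → BarSimplex v →
    toChain (insertAt v (suc i) (zeroP n)) ≡ insertAt (toChain v) (inject₁ i) (lookup (toChain v) i)
  toChain-degen i (a ∷ as) h = partialJoins-degen a as i (∧-projˡ (∧-projˡ h))

  toChain-simplex : ∀ {m} (v : Vec RawPart (suc m)) → BarSimplex v → NerveSimplex (toChain v)
  toChain-simplex (a ∷ as) h = partialJoins-chain a as (∧-projˡ (∧-projˡ h))

  fromChain-simplex : ∀ {m} (v : Vec RawPart (suc m)) → NerveSimplex v → BarSimplex (fromChain v)
  fromChain-simplex (x ∷ xs) h =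
    ∧-intro (allB⁺ (fromChain (x ∷ xs)) ncps)
      (Shuffle.AllPairs⇒admissible n x (toList (complements x xs)) ncps
        (complements-admissible x x xs chained (λ _ _ _ _ s → s) ∷ complements-AllPairs x xs chained))
    where
      ncps : All (NCP n) (x ∷ toList (complements x xs))
      ncps = ∧-projˡ (∧-projˡ h) ∷ complements-NCP x xs (∧-projʳ (isNCP n x) (∧-projˡ h))
      chained : T (chain n (x ∷ xs))
      chained = ∧-projʳ (allB (isNCP n) (x ∷ xs)) h

  fromChain-toChain : ∀ {m} (v : Vec RawPart (suc m)) → BarSimplex v → fromChain (toChain v) ≡ v
  fromChain-toChain (a ∷ as) h
    with allB⁻ (a ∷ as) (∧-projˡ h) | Shuffle.admissible⇒AllPairs n a (toList as) (∧-projʳ (allB (isNCP n) (a ∷ as)) h)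
  ... | a-ncp ∷ as-ncp | a-adm ∷ as-adm = cong (a ∷_) (complements-partialJoins a as a-ncp as-ncp a-adm as-adm)

  toChain-fromChain : ∀ {m} (v : Vec RawPart (suc m)) → NerveSimplex v → toChain (fromChain v) ≡ v
  toChain-fromChain (x ∷ xs) h = cong (x ∷_) (partialJoins-complements x xs
    (∧-projˡ (∧-projˡ h)) (∧-projʳ (isNCP n x) (∧-projˡ h)) (∧-projʳ (allB (isNCP n) (x ∷ xs)) h))

proposition5p6 : (n : ℕ) → 1 ≤ n → Decalage (Bar n) ≅ Nerve n
proposition5p6 n _ = record
  { to       = λ _ → toChain n
  ; from     = λ _ → fromChain n
  ; to-in    = λ _ → toChain-simplex n
  ; from-in  = λ _ → fromChain-simplex n
  ; from-to  = λ _ → fromChain-toChain n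
  ; to-from  = λ _ → toChain-fromChain n
  ; to-face  = λ _ i v _ → toChain-face n i v
  ; to-degen = λ _ → toChain-degen n
  }
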